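{- Let $n\ge1$ and $C=\{LT(\mathbf{m}_A[X_n]): A\text{ nonsplitable},\ \ell(A)\le n\}$. The set $\{u\,\mathbf{m}_A[X_n]: u\in X_n^*,\ A \text{ nonsplitable set partition with } \ell(A)\le n\}$ is a linear basis of the left ideal $\langle\mathrm{NCSym}_n^+\rangle$, and every word $w\in X_n^*C=\{uv:u\in X_n^*,v\in C\}$ can be written uniquely as $w=uv$ with $u\in X_n^*$ and $v\in C$.
   Context: $X_n=\{x_1<\dots<x_n\}$, $X_n^*$ the words, $\mathbb{Q}\langle X_n\rangle$ the free associative algebra. For a set partition $A\vdash[m]$ with blocks $A_1,\dots,A_{\ell(A)}$ ordered by increasing minimum, $\mathbf{m}_A[X_n]=\sum x_{i_1}\cdots x_{i_m}$ over sequences in $[n]^m$ with $i_a=i_b$ iff $a,b$ in the same block; $LT$ denotes the lexicographically smallest monomial (for $\mathbf{m}_A[X_n]$, the word whose $k$-th letter is $x_i$ with $k\in A_i$). $\mathrm{NCSym}_n$ is the span of the $\mathbf{m}_A[X_n]$, and $\langle\mathrm{NCSym}_n^+\rangle$ the left ideal of $\mathbb{Q}\langle X_n\rangle$ generated by its elements without constant term. For $A\vdash[n']$ with $k$ blocks and $B\vdash[m]$ with $\ell$ blocks, $A\circ B\vdash[n'+m]$ consists of the blocks $A_i\cup(B_i+n')$ for $i\le\min(k,\ell)$ plus the remaining unpaired blocks $A_i$ or $B_i+n'$. A nonempty set partition is nonsplitable if it is not $B\circ C$ with $B,C$ nonempty. -}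

module Defs where

open import Data.Bool using (Bool; true; false; _∧_; if_then_else_)
open import Data.Nat using (ℕ; zero; suc; _≤_; _<_; _⊔_; _≡ᵇ_)
import Data.Nat as ℕ
open import Data.Fin using (Fin; toℕ; fromℕ<)
import Data.Fin as Fin
open import Data.List using (List; []; _∷_; _++_; map; concatMap; allFin; filterᵇ; zip; length; foldr)
import Data.List.Properties as LP
open import Data.List.Relation.Unary.All using (All)
open import Data.Product using (Σ; ∃; _×_; _,_; proj₁; proj₂)
open import Data.Rational using (ℚ; 0ℚ; 1ℚ; _+_; _*_)
open import Relation.Binary.PropositionalEquality using (_≡_; _≢_; refl)
open import Relation.Nullary using (¬_; Dec; yes; no)
open import Relation.Nullary.Decidable using (⌊_⌋)

-- Words over X_n = {x_1 < ... < x_n}: letter x_{i+1} is encoded by i : Fin n.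

Word : ℕ → Set
Word n = List (Fin n)

-- Set partitions of [m], encoded as restricted growth functions:
-- the list (a_1,...,a_m) where a_k = i-1 iff k ∈ A_i, blocks A_1,A_2,...
-- ordered by increasing minimum.  A list is such an encoding iff
-- a_1 = 0 and each a_k ≤ 1 + max(a_1..a_{k-1}).

data RGF : ℕ → List ℕ → Set where
  []  : ∀ {k} → RGF k []
  _∷_ : ∀ {k a as} → a ≤ k → RGF (k ⊔ suc a) as → RGF k (a ∷ as)

IsSetPartition : List ℕ → Set
IsSetPartition A = RGF 0 A

ℓ : List ℕ → ℕ
ℓ = foldr (λ a r → suc a ⊔ r) 0

-- A ∘ B : in the block-label encoding, block A_i ∪ (B_i + n') keeps label i,
-- unpaired blocks keep their own index; this is exactly concatenation.
_∘ₚ_ : List ℕ → List ℕ → List ℕ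
A ∘ₚ B = A ++ B

Nonsplitable : List ℕ → Set
Nonsplitable A =
  A ≢ [] ×
  ¬ (Σ (List ℕ) λ B → Σ (List ℕ) λ C →
       IsSetPartition B × IsSetPartition C × B ≢ [] × C ≢ [] × A ≡ B ∘ₚ C)

-- Noncommutative polynomials Q<X_n> as finite formal sums, with
-- equality meaning equality of all coefficients.

Poly : ℕ → Set
Poly n = List (ℚ × Word n)

coeff : ∀ {n} → Poly n → Word n → ℚ
coeff [] w = 0ℚ
coeff ((c , v) ∷ p) w with LP.≡-dec Fin._≟_ v w
... | yes _ = c + coeff p w
... | no  _ = coeff p w

infix 4 _≈_
_≈_ : ∀ {n} → Poly n → Poly n → Set
p ≈ q = ∀ w → coeff p w ≡ coeff q w

scale : ∀ {n} → ℚ → Poly n → Poly n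
scale c = map (λ { (d , v) → (c * d , v) })

_*ₚ_ : ∀ {n} → Poly n → Poly n → Poly n
p *ₚ q = concatMap (λ { (c , u) → map (λ { (d , v) → (c * d , u ++ v) }) q }) p

wordMul : ∀ {n} → Word n → Poly n → Poly n
wordMul u = map (λ { (d , v) → (d , u ++ v) })

allWords : (n m : ℕ) → List (Word n)
allWords n zero    = [] ∷ []
allWords n (suc m) = concatMap (λ i → map (i ∷_) (allWords n m)) (allFin n)

-- for pairs (i_a , label of a): i_a = i_b iff a, b in the same block
_==ᵇ_ : Bool → Bool → Bool
true  ==ᵇ true  = true
false ==ᵇ false = true
_     ==ᵇ _     = false

allᵇ : ∀ {A : Set} → (A → Bool) → List A → Bool
allᵇ p [] = true
allᵇ p (x ∷ xs) = p x ∧ allᵇ p xs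

agree : ∀ {n} → List (Fin n × ℕ) → Bool
agree [] = true
agree ((x , a) ∷ ps) =
  allᵇ (λ { (y , b) → ⌊ x Fin.≟ y ⌋ ==ᵇ (a ≡ᵇ b) }) ps ∧ agree ps

mA : (n : ℕ) → List ℕ → Poly n
mA n A = map (λ w → (1ℚ , w)) (filterᵇ (λ w → agree (zip w A)) (allWords n (length A)))

-- LT(m_A[X_n]) : the word whose k-th letter is x_i with k ∈ A_i
-- (requires every label < n, i.e. ℓ(A) ≤ n)
LT-mA : ∀ {n} (A : List ℕ) → All (_< n) A → Word n
LT-mA [] All.[] = []
LT-mA (a ∷ A) (a<n All.∷ p) = fromℕ< a<n ∷ LT-mA A p

InNCSym : (n : ℕ) → Poly n → Set
InNCSym n f =
  Σ (List (ℚ × List ℕ)) λ L →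
    All (λ cA → IsSetPartition (proj₂ cA)) L ×
    f ≈ concatMap (λ { (c , A) → scale c (mA n A) }) L

InNCSym⁺ : (n : ℕ) → Poly n → Set
InNCSym⁺ n f = InNCSym n f × coeff f [] ≡ 0ℚ

InIdeal : (n : ℕ) → Poly n → Set
InIdeal n p =
  Σ (List (Poly n × Poly n)) λ L →
    All (λ qf → InNCSym⁺ n (proj₂ qf)) L ×
    p ≈ concatMap (λ { (q , f) → q *ₚ f }) L

IsBasisIndex : (n : ℕ) → Word n × List ℕ → Set
IsBasisIndex n (u , A) = IsSetPartition A × Nonsplitable A × ℓ A ≤ n

basisElt : (n : ℕ) → Word n × List ℕ → Poly n
basisElt n (u , A) = wordMul u (mA n A)

comb : (n : ℕ) → List (ℚ × (Word n × List ℕ)) → Poly n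
comb n = concatMap (λ { (c , i) → scale c (basisElt n i) })

decIdx : ∀ {n} (i j : Word n × List ℕ) → Dec (i ≡ j)
decIdx (u , A) (v , B) with LP.≡-dec Fin._≟_ u v | LP.≡-dec ℕ._≟_ A B
... | yes refl | yes refl = yes refl
... | no ne    | _        = no λ { refl → ne refl }
... | yes _    | no ne    = no λ { refl → ne refl }

idxCoeff : ∀ {n} → List (ℚ × (Word n × List ℕ)) → Word n × List ℕ → ℚ
idxCoeff [] i = 0ℚ
idxCoeff ((c , j) ∷ L) i with decIdx j i
... | yes _ = c + idxCoeff L i
... | no  _ = idxCoeff L i

IsLinearBasisOfIdeal : (n : ℕ) → Set
IsLinearBasisOfIdeal n =
  (∀ i → IsBasisIndex n i → InIdeal n (basisElt n i)) ×
  (∀ p → InIdeal n p →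
     Σ (List (ℚ × (Word n × List ℕ))) λ L →
       All (λ ci → IsBasisIndex n (proj₂ ci)) L × p ≈ comb n L) ×
  (∀ (L : List (ℚ × (Word n × List ℕ))) →
     All (λ ci → IsBasisIndex n (proj₂ ci)) L →
     comb n L ≈ [] → ∀ i → idxCoeff L i ≡ 0ℚ)

InC : (n : ℕ) → Word n → Set
InC n v =
  Σ (List ℕ) λ A → IsSetPartition A × Nonsplitable A ×
    Σ (All (_< n) A) λ bd → v ≡ LT-mA A bd

InXC : (n : ℕ) → Word n → Set
InXC n w = Σ (Word n) λ u → Σ (Word n) λ v → InC n v × w ≡ u ++ v

UniqueFactorisation : (n : ℕ) → Set
UniqueFactorisation n =
  ∀ (w : Word n) → InXC n w →
    ∀ u v u′ v′ → InC n v → w ≡ u ++ v → InC n v′ → w ≡ u′ ++ v′ →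
      u ≡ u′ × v ≡ v′

-- The coefficient of a word w in m_A is 1 exactly when std w = A, where std w partitions the positions
-- of w by equal letters.
-- Spanning: a set partition D splits as P ++ C with C its shortest nonempty suffix that is a set
-- partition, which is nonsplitable, so m_C is a basis element (or 0 when ℓ(C) > n). Moreover
-- m_P m_C = m_D + ∑ m_E over the E = P ++ y ≠ D with std y = C, all lexicographically above D because
-- std y ≤lex y; downward induction along the lexicographic order puts every m_D, hence the ideal, in
-- the span.
-- Independence: u m_A has coefficient 1 at its leading word u LT(A). A word of C has no proper suffix
-- in C (that would split A), which gives unique factorisation; hence a basis element other than u m_A
-- can only contain u LT(A) if its own leading word is lexicographically smaller. Evaluating a vanishing
-- combination at leading words, from the bottom up, kills every coefficient.

module Submission where

open import Defs
open import Data.Bool using (Bool; true; false; T; _∧_; if_then_else_)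
open import Data.Nat using (ℕ; zero; suc; _≤_; _<_; _⊔_; _⊓_; _∸_; _^_; _≡ᵇ_; z≤n; s≤s)
  renaming (_+_ to _+ℕ_; _*_ to _*ℕ_; _≟_ to _≟ℕ_)
import Data.Nat.Properties as ℕ
open import Data.Nat.Induction using (<-wellFounded)
open import Data.Fin using (Fin; toℕ) renaming (_≟_ to _≟F_; _<_ to _<F_)
import Data.Fin.Properties as Fin
open import Data.List using (List; []; _∷_; _++_; map; concatMap; allFin; filter; filterᵇ; zip; length; take; drop; [_]; upTo)
import Data.List.Properties as List
open import Data.List.Relation.Unary.All using (All; []; _∷_)
import Data.List.Relation.Unary.All as All
import Data.List.Relation.Unary.All.Properties as All
open import Data.List.Relation.Unary.AllPairs using (AllPairs; []; _∷_)
import Data.List.Relation.Unary.AllPairs as AllPairs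
import Data.List.Relation.Unary.AllPairs.Properties as AllPairs
open import Data.List.Relation.Unary.Any using (Any; here; there; any?)
open import Data.List.Relation.Unary.Unique.Propositional using (Unique)
import Data.List.Relation.Unary.Unique.Propositional.Properties as Unique
open import Data.List.Membership.Propositional using (_∈_; _∉_; find)
import Data.List.Membership.Propositional.Properties as ∈
open import Data.Product using (Σ; ∃; ∃₂; _×_; _,_; proj₁; proj₂; swap)
open import Data.Sum using (_⊎_; inj₁; inj₂)
open import Data.Maybe using (Maybe; just; nothing)
open import Data.Empty using (⊥-elim)
open import Data.Rational using (ℚ; 0ℚ; 1ℚ; _+_; _*_; -_)
import Data.Rational.Properties as ℚ
open import Data.Rational.Solver using (module +-*-Solver)
open +-*-Solver using (solve; _:+_; _:*_; _:=_)
open import Relation.Binary.PropositionalEquality hiding ([_])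
open import Relation.Binary.Definitions using (DecidableEquality; tri<; tri≈; tri>)
open import Relation.Nullary using (¬_; Dec; yes; no; does; _×-dec_; ¬?)
open import Relation.Nullary.Decidable using (⌊_⌋; dec-true; dec-false)
open import Induction.WellFounded using (Acc; acc)
open import Function using (_∘_; id)

take-length-++ : ∀ {A : Set} (u v : List A) → take (length u) (u ++ v) ≡ u
take-length-++ [] v = refl
take-length-++ (x ∷ u) v = cong (x ∷_) (take-length-++ u v)

drop-length-++ : ∀ {A : Set} (u v : List A) → drop (length u) (u ++ v) ≡ v
drop-length-++ [] v = refl
drop-length-++ (x ∷ u) v = drop-length-++ u v

++-split : ∀ {A : Set} (u v u′ v′ : List A) → u ++ v ≡ u′ ++ v′ →
           (∃ λ s → u′ ≡ u ++ s × v ≡ s ++ v′) ⊎ (∃ λ s → u ≡ u′ ++ s × v′ ≡ s ++ v)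
++-split [] v u′ v′ eq = inj₁ (u′ , refl , eq)
++-split (x ∷ u) v [] v′ eq = inj₂ (x ∷ u , refl , sym eq)
++-split (x ∷ u) v (y ∷ u′) v′ eq with List.∷-injectiveˡ eq | ++-split u v u′ v′ (List.∷-injectiveʳ eq)
... | refl | inj₁ (s , u′≡ , v≡) = inj₁ (s , cong (x ∷_) u′≡ , v≡)
... | refl | inj₂ (s , u≡ , v′≡) = inj₂ (s , cong (x ∷_) u≡ , v′≡)

∈-++-[_]⁻ : ∀ {A : Set} {p : A} z (d : List A) → p ∈ d ++ [ z ] → p ∈ d ⊎ p ≡ z
∈-++-[ z ]⁻ d p∈ with ∈.∈-++⁻ d p∈
... | inj₁ p∈d = inj₁ p∈d
... | inj₂ (here p≡z) = inj₂ p≡z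

RGF-take : ∀ {k} p (A : List ℕ) → RGF k A → RGF k (take p A)
RGF-take zero A rgf = []
RGF-take (suc p) [] rgf = []
RGF-take (suc p) (a ∷ A) (a≤ ∷ rgf) = a≤ ∷ RGF-take p A rgf

RGF-++ˡ : ∀ {k} (A B : List ℕ) → RGF k (A ++ B) → RGF k A
RGF-++ˡ [] B _ = []
RGF-++ˡ (a ∷ A) B (a≤ ∷ rgf) = a≤ ∷ RGF-++ˡ A B rgf

RGF-< : ∀ {k} A → RGF k A → All (_< k +ℕ length A) A
RGF-< [] [] = []
RGF-< {k} (a ∷ A) (a≤k ∷ rgf) = a< ∷ All.map (λ x< → ℕ.<-≤-trans x< bound) (RGF-< A rgf)
  where
  a< : a < k +ℕ suc (length A)
  a< = subst (a <_) (sym (ℕ.+-suc k (length A))) (s≤s (ℕ.≤-trans a≤k (ℕ.m≤m+n k (length A))))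
  bound : (k ⊔ suc a) +ℕ length A ≤ k +ℕ suc (length A)
  bound = ℕ.≤-trans (ℕ.+-monoˡ-≤ (length A) (ℕ.⊔-lub (ℕ.n≤1+n k) (s≤s a≤k)))
                    (ℕ.≤-reflexive (sym (ℕ.+-suc k (length A))))

rgf? : ∀ k A → Dec (RGF k A)
rgf? k [] = yes []
rgf? k (a ∷ A) with a ℕ.≤? k | rgf? (k ⊔ suc a) A
... | yes a≤k | yes rgf = yes (a≤k ∷ rgf)
... | no a≰k  | _       = no λ { (a≤k ∷ _) → a≰k a≤k }
... | yes _   | no ¬rgf = no λ { (_ ∷ rgf) → ¬rgf rgf }

ℓ≤⇒All< : ∀ {n} A → ℓ A ≤ n → All (_< n) A
ℓ≤⇒All< [] _ = []
ℓ≤⇒All< (a ∷ A) ℓ≤n =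
  ℕ.≤-trans (ℕ.m≤m⊔n (suc a) (ℓ A)) ℓ≤n ∷ ℓ≤⇒All< A (ℕ.≤-trans (ℕ.m≤n⊔m (suc a) (ℓ A)) ℓ≤n)

All<⇒ℓ≤ : ∀ {n} A → All (_< n) A → ℓ A ≤ n
All<⇒ℓ≤ [] [] = z≤n
All<⇒ℓ≤ (a ∷ A) (a<n ∷ A<n) = ℕ.⊔-lub a<n (All<⇒ℓ≤ A A<n)

toℕ-LT-mA : ∀ {n} A (A<n : All (_< n) A) → map toℕ (LT-mA A A<n) ≡ A
toℕ-LT-mA [] [] = refl
toℕ-LT-mA (a ∷ A) (a<n ∷ A<n) = cong₂ _∷_ (Fin.toℕ-fromℕ< a<n) (toℕ-LT-mA A A<n)

∑ : ∀ {A : Set} → (A → ℚ) → List A → ℚ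
∑ f [] = 0ℚ
∑ f (x ∷ xs) = f x + ∑ f xs

module _ {A : Set} where

  ∑-++ : ∀ (f : A → ℚ) xs ys → ∑ f (xs ++ ys) ≡ ∑ f xs + ∑ f ys
  ∑-++ f [] ys = sym (ℚ.+-identityˡ _)
  ∑-++ f (x ∷ xs) ys = trans (cong (f x +_) (∑-++ f xs ys)) (sym (ℚ.+-assoc (f x) _ _))

  ∑-cong : ∀ {f g : A → ℚ} xs → (∀ x → x ∈ xs → f x ≡ g x) → ∑ f xs ≡ ∑ g xs
  ∑-cong [] h = refl
  ∑-cong (x ∷ xs) h = cong₂ _+_ (h x (here refl)) (∑-cong xs (λ y y∈ → h y (there y∈)))

  ∑-zero : ∀ {f : A → ℚ} xs → (∀ x → x ∈ xs → f x ≡ 0ℚ) → ∑ f xs ≡ 0ℚ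
  ∑-zero xs h = trans (∑-cong xs h) (∑-const-0 xs)
    where
    ∑-const-0 : ∀ (xs : List A) → ∑ (λ _ → 0ℚ) xs ≡ 0ℚ
    ∑-const-0 [] = refl
    ∑-const-0 (_ ∷ xs) = trans (ℚ.+-identityˡ _) (∑-const-0 xs)

  ∑-filter : ∀ {P : A → Set} (P? : ∀ x → Dec (P x)) (f : A → ℚ) xs →
             ∑ f (filter P? xs) ≡ ∑ (λ x → if does (P? x) then f x else 0ℚ) xs
  ∑-filter P? f [] = refl
  ∑-filter P? f (x ∷ xs) with does (P? x)
  ... | true  = cong (f x +_) (∑-filter P? f xs)
  ... | false = trans (∑-filter P? f xs) (sym (ℚ.+-identityˡ _))

  ∑-point : ∀ {f : A → ℚ} {x} xs → Unique xs → x ∈ xs → (∀ y → y ≢ x → f y ≡ 0ℚ) → ∑ f xs ≡ f x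
  ∑-point {f} (y ∷ ys) (y∉ys ∷ _) (here refl) h =
    trans (cong (f y +_) (∑-zero ys (λ z z∈ → h z (All.lookup y∉ys z∈ ∘ sym)))) (ℚ.+-identityʳ _)
  ∑-point (y ∷ ys) (y∉ys ∷ u) (there x∈) h =
    trans (cong₂ _+_ (h y (λ { refl → All.lookup y∉ys x∈ refl })) (∑-point ys u x∈ h)) (ℚ.+-identityˡ _)

∑-map : ∀ {A B : Set} (f : B → ℚ) (g : A → B) xs → ∑ f (map g xs) ≡ ∑ (f ∘ g) xs
∑-map f g [] = refl
∑-map f g (x ∷ xs) = cong (f (g x) +_) (∑-map f g xs)

∑-concatMap : ∀ {A B : Set} (f : B → ℚ) (g : A → List B) xs → ∑ f (concatMap g xs) ≡ ∑ (∑ f ∘ g) xs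
∑-concatMap f g [] = refl
∑-concatMap f g (x ∷ xs) = trans (∑-++ f (g x) _) (cong (∑ f (g x) +_) (∑-concatMap f g xs))

𝟙 : ∀ {P : Set} → Dec P → ℚ
𝟙 P? = if does P? then 1ℚ else 0ℚ

𝟙-yes : ∀ {P : Set} (P? : Dec P) → P → 𝟙 P? ≡ 1ℚ
𝟙-yes (yes _) _ = refl
𝟙-yes (no ¬p) p = ⊥-elim (¬p p)

𝟙-no : ∀ {P : Set} (P? : Dec P) → ¬ P → 𝟙 P? ≡ 0ℚ
𝟙-no (yes p) ¬p = ⊥-elim (¬p p)
𝟙-no (no _) _ = refl

if-0 : ∀ b → (if b then 0ℚ else 0ℚ) ≡ 0ℚ
if-0 true = refl
if-0 false = refl

𝟙-× : ∀ {P Q : Set} (P? : Dec P) (Q? : Dec Q) → 𝟙 P? * 𝟙 Q? ≡ 𝟙 (P? ×-dec Q?)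
𝟙-× (yes _) (yes _) = refl
𝟙-× (yes _) (no _)  = refl
𝟙-× (no _)  Q?      = ℚ.*-zeroˡ (𝟙 Q?)

𝟙-split : ∀ {Q R : Set} (Q? : Dec Q) (R? : Dec R) → (R → Q) → 𝟙 R? ≡ 𝟙 Q? + - 1ℚ * 𝟙 (Q? ×-dec ¬? R?)
𝟙-split (yes _) (yes _) _ = refl
𝟙-split (yes _) (no _) _ = refl
𝟙-split (no _) (no _) _ = refl
𝟙-split (no ¬q) (yes r) R⇒Q = ⊥-elim (¬q (R⇒Q r))

𝟙≢0 : ∀ {P : Set} (P? : Dec P) → 𝟙 P? ≢ 0ℚ → P
𝟙≢0 (yes p) _ = p
𝟙≢0 (no _) 𝟙≢0ℚ = ⊥-elim (𝟙≢0ℚ refl)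

𝟙*≢0 : ∀ {P : Set} (P? : Dec P) x → 𝟙 P? * x ≢ 0ℚ → P × x ≢ 0ℚ
𝟙*≢0 P? x ≢0 = 𝟙≢0 P? (λ 𝟙≡0 → ≢0 (trans (cong (_* x) 𝟙≡0) (ℚ.*-zeroˡ x))) ,
               (λ x≡0 → ≢0 (trans (cong (𝟙 P? *_) x≡0) (ℚ.*-zeroʳ (𝟙 P?))))

-- Lexicographic order

infix 4 _<lex_

-- Only lists of equal length are compared.
data _<lex_ : List ℕ → List ℕ → Set where
  here  : ∀ {x y xs ys} → x < y → length xs ≡ length ys → x ∷ xs <lex y ∷ ys
  there : ∀ {x xs ys} → xs <lex ys → x ∷ xs <lex x ∷ ys

<lex-length : ∀ {xs ys} → xs <lex ys → length xs ≡ length ys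
<lex-length (here _ |xs|) = cong suc |xs|
<lex-length (there lt) = cong suc (<lex-length lt)

<lex-++ : ∀ P {xs ys} → xs <lex ys → P ++ xs <lex P ++ ys
<lex-++ [] lt = lt
<lex-++ (p ∷ P) lt = there (<lex-++ P lt)

infix 4 _≤lex_

_≤lex_ : List ℕ → List ℕ → Set
xs ≤lex ys = xs <lex ys ⊎ xs ≡ ys

∷-≤lex : ∀ x {xs ys} → xs ≤lex ys → x ∷ xs ≤lex x ∷ ys
∷-≤lex x (inj₁ lt) = inj₁ (there lt)
∷-≤lex x (inj₂ eq) = inj₂ (cong (x ∷_) eq)

horner : ℕ → List ℕ → ℕ
horner B [] = 0
horner B (x ∷ xs) = x *ℕ B ^ length xs +ℕ horner B xs

horner-∷-< : ∀ B x xs → All (_< B) xs → horner B (x ∷ xs) < suc x *ℕ B ^ length xs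
horner-< : ∀ B xs → All (_< B) xs → horner B xs < B ^ length xs

horner-∷-< B x xs xs<B = begin-strict
  x *ℕ B ^ length xs +ℕ horner B xs    <⟨ ℕ.+-monoʳ-< (x *ℕ B ^ length xs) (horner-< B xs xs<B) ⟩
  x *ℕ B ^ length xs +ℕ B ^ length xs  ≡⟨ ℕ.+-comm (x *ℕ B ^ length xs) _ ⟩
  suc x *ℕ B ^ length xs                ∎
  where open ℕ.≤-Reasoning

horner-< B [] [] = s≤s z≤n
horner-< B (x ∷ xs) (x<B ∷ xs<B) = ℕ.<-≤-trans (horner-∷-< B x xs xs<B) (ℕ.*-monoˡ-≤ (B ^ length xs) x<B)

horner-<lex : ∀ B {xs ys} → All (_< B) xs → All (_< B) ys → xs <lex ys → horner B xs < horner B ys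
horner-<lex B {x ∷ xs} {y ∷ ys} (_ ∷ xs<B) _ (here x<y |xs|) = begin-strict
  horner B (x ∷ xs)                     <⟨ horner-∷-< B x xs xs<B ⟩
  suc x *ℕ B ^ length xs                ≤⟨ ℕ.*-monoˡ-≤ (B ^ length xs) x<y ⟩
  y *ℕ B ^ length xs                    ≡⟨ cong (λ k → y *ℕ B ^ k) |xs| ⟩
  y *ℕ B ^ length ys                    ≤⟨ ℕ.m≤m+n (y *ℕ B ^ length ys) (horner B ys) ⟩
  horner B (y ∷ ys)                     ∎
  where open ℕ.≤-Reasoning
horner-<lex B {x ∷ xs} {x ∷ ys} (_ ∷ xs<B) (_ ∷ ys<B) (there lt) rewrite <lex-length lt =
  ℕ.+-monoʳ-< (x *ℕ B ^ length ys) (horner-<lex B xs<B ys<B lt)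

infix 4 _≟W_ _≟L_

_≟W_ : ∀ {n} → DecidableEquality (Word n)
_≟W_ = List.≡-dec _≟F_

_≟L_ : DecidableEquality (List ℕ)
_≟L_ = List.≡-dec _≟ℕ_

module _ {n : ℕ} where

  ≈-reflexive : ∀ {p q : Poly n} → p ≡ q → p ≈ q
  ≈-reflexive refl w = refl

  ≈-trans : ∀ {p q r : Poly n} → p ≈ q → q ≈ r → p ≈ r
  ≈-trans p≈q q≈r w = trans (p≈q w) (q≈r w)

  ≈-≡ : ∀ {p q r : Poly n} → p ≈ q → q ≡ r → p ≈ r
  ≈-≡ p≈q refl = p≈q

  coeff-∷ : ∀ c u (p : Poly n) w → coeff ((c , u) ∷ p) w ≡ c * 𝟙 (u ≟W w) + coeff p w
  coeff-∷ c u p w with u ≟W w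
  ... | yes _ = cong (_+ coeff p w) (sym (ℚ.*-identityʳ c))
  ... | no _  = trans (sym (ℚ.+-identityˡ (coeff p w))) (cong (_+ coeff p w) (sym (ℚ.*-zeroʳ c)))

  coeff-++ : ∀ (p q : Poly n) w → coeff (p ++ q) w ≡ coeff p w + coeff q w
  coeff-++ [] q w = sym (ℚ.+-identityˡ _)
  coeff-++ ((c , u) ∷ p) q w = begin
    coeff ((c , u) ∷ (p ++ q)) w                  ≡⟨ coeff-∷ c u (p ++ q) w ⟩
    c * 𝟙 (u ≟W w) + coeff (p ++ q) w             ≡⟨ cong (c * 𝟙 (u ≟W w) +_) (coeff-++ p q w) ⟩
    c * 𝟙 (u ≟W w) + (coeff p w + coeff q w)      ≡⟨ sym (ℚ.+-assoc (c * 𝟙 (u ≟W w)) (coeff p w) (coeff q w)) ⟩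
    (c * 𝟙 (u ≟W w) + coeff p w) + coeff q w      ≡⟨ cong (_+ coeff q w) (sym (coeff-∷ c u p w)) ⟩
    coeff ((c , u) ∷ p) w + coeff q w             ∎
    where open ≡-Reasoning

  coeff-concatMap : ∀ {A : Set} (g : A → Poly n) xs w → coeff (concatMap g xs) w ≡ ∑ (λ x → coeff (g x) w) xs
  coeff-concatMap g [] w = refl
  coeff-concatMap g (x ∷ xs) w =
    trans (coeff-++ (g x) (concatMap g xs) w) (cong (coeff (g x) w +_) (coeff-concatMap g xs w))

  coeff-scale : ∀ c (p : Poly n) w → coeff (scale c p) w ≡ c * coeff p w
  coeff-scale c [] w = sym (ℚ.*-zeroʳ c)
  coeff-scale c ((d , u) ∷ p) w = begin
    coeff ((c * d , u) ∷ scale c p) w          ≡⟨ coeff-∷ (c * d) u (scale c p) w ⟩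
    c * d * 𝟙 (u ≟W w) + coeff (scale c p) w  ≡⟨ cong (c * d * 𝟙 (u ≟W w) +_) (coeff-scale c p w) ⟩
    c * d * 𝟙 (u ≟W w) + c * coeff p w        ≡⟨ solve 4 (λ c d e x → c :* d :* e :+ c :* x := c :* (d :* e :+ x))
                                                     refl c d (𝟙 (u ≟W w)) (coeff p w) ⟩
    c * (d * 𝟙 (u ≟W w) + coeff p w)          ≡⟨ cong (c *_) (sym (coeff-∷ d u p w)) ⟩
    c * coeff ((d , u) ∷ p) w                 ∎
    where open ≡-Reasoning

  scale-≈ : ∀ c {p q : Poly n} → p ≈ q → scale c p ≈ scale c q
  scale-≈ c {p} {q} p≈q w = trans (coeff-scale c p w) (trans (cong (c *_) (p≈q w)) (sym (coeff-scale c q w)))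

  ++-≈ : ∀ {p p′ q q′ : Poly n} → p ≈ p′ → q ≈ q′ → p ++ q ≈ p′ ++ q′
  ++-≈ {p} {p′} {q} {q′} p≈p′ q≈q′ w =
    trans (coeff-++ p q w) (trans (cong₂ _+_ (p≈p′ w) (q≈q′ w)) (sym (coeff-++ p′ q′ w)))

  coeff-wordMul-++ : ∀ u (p : Poly n) v → coeff (wordMul u p) (u ++ v) ≡ coeff p v
  coeff-wordMul-++ u [] v = refl
  coeff-wordMul-++ u ((d , v′) ∷ p) v = begin
    coeff ((d , u ++ v′) ∷ wordMul u p) (u ++ v)
      ≡⟨ coeff-∷ d (u ++ v′) (wordMul u p) (u ++ v) ⟩
    d * 𝟙 (u ++ v′ ≟W u ++ v) + coeff (wordMul u p) (u ++ v)
      ≡⟨ cong₂ (λ x y → d * x + y) (𝟙-cancel (u ++ v′ ≟W u ++ v) (v′ ≟W v)) (coeff-wordMul-++ u p v) ⟩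
    d * 𝟙 (v′ ≟W v) + coeff p v
      ≡⟨ sym (coeff-∷ d v′ p v) ⟩
    coeff ((d , v′) ∷ p) v
      ∎
    where
    open ≡-Reasoning
    𝟙-cancel : (e : Dec (u ++ v′ ≡ u ++ v)) (e′ : Dec (v′ ≡ v)) → 𝟙 e ≡ 𝟙 e′
    𝟙-cancel (yes _) (yes _)  = refl
    𝟙-cancel (no ne) (yes refl) = ⊥-elim (ne refl)
    𝟙-cancel (yes eq) (no ne)  = ⊥-elim (ne (List.++-cancelˡ u v′ v eq))
    𝟙-cancel (no _) (no _)    = refl

  coeff-wordMul-∉ : ∀ u (p : Poly n) w → (∀ v → w ≢ u ++ v) → coeff (wordMul u p) w ≡ 0ℚ
  coeff-wordMul-∉ u [] w _ = refl
  coeff-wordMul-∉ u ((d , v) ∷ p) w w∉ with u ++ v ≟W w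
  ... | yes refl = ⊥-elim (w∉ v refl)
  ... | no _     = coeff-wordMul-∉ u p w w∉

  coeff-wordMul : ∀ u (p : Poly n) w →
    coeff (wordMul u p) w ≡ 𝟙 (u ≟W take (length u) w) * coeff p (drop (length u) w)
  coeff-wordMul u p w with u ≟W take (length u) w
  ... | yes u≡ = begin
    coeff (wordMul u p) w                    ≡⟨ cong (coeff (wordMul u p)) w≡u++v ⟩
    coeff (wordMul u p) (u ++ v)             ≡⟨ coeff-wordMul-++ u p v ⟩
    coeff p v                                ≡⟨ sym (ℚ.*-identityˡ (coeff p v)) ⟩
    1ℚ * coeff p v                           ∎
    where
    open ≡-Reasoning
    v = drop (length u) w
    w≡u++v : w ≡ u ++ v
    w≡u++v = trans (sym (List.take++drop≡id (length u) w)) (cong (_++ v) (sym u≡))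
  ... | no u≢ = trans (coeff-wordMul-∉ u p w w∉) (sym (ℚ.*-zeroˡ (coeff p (drop (length u) w))))
    where
    w∉ : ∀ v → w ≢ u ++ v
    w∉ v refl = u≢ (sym (take-length-++ u v))

  wordMul-≈ : ∀ u {p q : Poly n} → p ≈ q → wordMul u p ≈ wordMul u q
  wordMul-≈ u {p} {q} p≈q w = begin
    coeff (wordMul u p) w                           ≡⟨ coeff-wordMul u p w ⟩
    𝟙 (u ≟W take |u| w) * coeff p (drop |u| w)      ≡⟨ cong (𝟙 (u ≟W take |u| w) *_) (p≈q (drop |u| w)) ⟩
    𝟙 (u ≟W take |u| w) * coeff q (drop |u| w)      ≡⟨ sym (coeff-wordMul u q w) ⟩
    coeff (wordMul u q) w                           ∎
    where
    open ≡-Reasoning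
    |u| = length u

  *ₚ-∷ : ∀ c u (p q : Poly n) → ((c , u) ∷ p) *ₚ q ≡ scale c (wordMul u q) ++ p *ₚ q
  *ₚ-∷ c u p q = cong (_++ p *ₚ q) (List.map-∘ q)

  Homogeneous : ℕ → Poly n → Set
  Homogeneous k = All (λ cu → length (proj₂ cu) ≡ k)

  coeff-*ₚ : ∀ {k} (p q : Poly n) w → Homogeneous k p →
             coeff (p *ₚ q) w ≡ coeff p (take k w) * coeff q (drop k w)
  coeff-*ₚ {k} [] q w [] = sym (ℚ.*-zeroˡ (coeff q (drop k w)))
  coeff-*ₚ ((c , u) ∷ p) q w (refl ∷ hom) = begin
    coeff (((c , u) ∷ p) *ₚ q) w                            ≡⟨ cong (λ r → coeff r w) (*ₚ-∷ c u p q) ⟩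
    coeff (scale c (wordMul u q) ++ p *ₚ q) w               ≡⟨ coeff-++ (scale c (wordMul u q)) (p *ₚ q) w ⟩
    coeff (scale c (wordMul u q)) w + coeff (p *ₚ q) w      ≡⟨ cong₂ _+_ (coeff-scale c (wordMul u q) w) (coeff-*ₚ p q w hom) ⟩
    c * coeff (wordMul u q) w + coeff p x * y               ≡⟨ cong (λ z → c * z + coeff p x * y) (coeff-wordMul u q w) ⟩
    c * (𝟙 (u ≟W x) * y) + coeff p x * y                    ≡⟨ solve 4 (λ c e a y → c :* (e :* y) :+ a :* y := (c :* e :+ a) :* y)
                                                                  refl c (𝟙 (u ≟W x)) (coeff p x) y ⟩
    (c * 𝟙 (u ≟W x) + coeff p x) * y                        ≡⟨ cong (_* y) (sym (coeff-∷ c u p x)) ⟩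
    coeff ((c , u) ∷ p) x * y                               ∎
    where
    open ≡-Reasoning
    x = take (length u) w
    y = coeff q (drop (length u) w)

  scale-scale : ∀ c d (p : Poly n) → scale c (scale d p) ≡ scale (c * d) p
  scale-scale c d p = trans (sym (List.map-∘ p)) (List.map-cong (λ { (e , v) → cong (_, v) (sym (ℚ.*-assoc c d e)) }) p)

  scale-1 : ∀ (p : Poly n) → scale 1ℚ p ≡ p
  scale-1 p = trans (List.map-cong (λ { (e , v) → cong (_, v) (ℚ.*-identityˡ e) }) p) (List.map-id p)

  wordMul-scale : ∀ u c (p : Poly n) → wordMul u (scale c p) ≡ scale c (wordMul u p)
  wordMul-scale u c p = trans (sym (List.map-∘ p)) (List.map-∘ p)

  wordMul-wordMul : ∀ u v (p : Poly n) → wordMul u (wordMul v p) ≡ wordMul (u ++ v) p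
  wordMul-wordMul u v p =
    trans (sym (List.map-∘ p)) (List.map-cong (λ { (d , w) → cong (d ,_) (sym (List.++-assoc u v w)) }) p)

Idx : ℕ → Set
Idx n = Word n × List ℕ

AllBasis : (n : ℕ) → List (ℚ × Idx n) → Set
AllBasis n = All (λ ci → IsBasisIndex n (proj₂ ci))

-- A record rather than a Σ-type, so that p can be inferred from InSpan n p.
record InSpan (n : ℕ) (p : Poly n) : Set where
  constructor spanned
  field
    combination : List (ℚ × Idx n)
    allBasis    : AllBasis n combination
    ≈-comb      : p ≈ comb n combination

module _ {n : ℕ} where

  term : ℚ × Idx n → Poly n
  term (c , i) = scale c (basisElt n i)

  map-comb : ∀ (f : ℚ × Word n → ℚ × Word n) (g : ℚ × Idx n → ℚ × Idx n) →
             (∀ ci → map f (term ci) ≡ term (g ci)) → ∀ L → map f (comb n L) ≡ comb n (map g L)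
  map-comb f g f∘term≡term∘g L = begin
    map f (concatMap term L)     ≡⟨ List.map-concatMap f term L ⟩
    concatMap (map f ∘ term) L   ≡⟨ List.concatMap-cong f∘term≡term∘g L ⟩
    concatMap (term ∘ g) L       ≡⟨ sym (List.concatMap-map term g L) ⟩
    concatMap term (map g L)     ∎
    where open ≡-Reasoning

  InSpan-≈ : ∀ {p q : Poly n} → p ≈ q → InSpan n q → InSpan n p
  InSpan-≈ {p} {q} p≈q (spanned L basis q≈L) = spanned L basis (≈-trans {p = p} {q} {comb n L} p≈q q≈L)

  InSpan-[] : InSpan n []
  InSpan-[] = spanned [] [] λ w → refl

  InSpan-++ : ∀ {p q : Poly n} → InSpan n p → InSpan n q → InSpan n (p ++ q)
  InSpan-++ {p} {q} (spanned L basisL p≈L) (spanned M basisM q≈M) =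
    spanned (L ++ M) (All.++⁺ basisL basisM)
      (≈-≡ {p = p ++ q} (++-≈ {p = p} {comb n L} {q} {comb n M} p≈L q≈M) (sym (List.concatMap-++ term L M)))

  InSpan-scale : ∀ c {p : Poly n} → InSpan n p → InSpan n (scale c p)
  InSpan-scale c {p} (spanned L basis p≈L) =
    spanned (map rescale L) (All.map⁺ basis)
      (≈-≡ {p = scale c p} (scale-≈ c {p} {comb n L} p≈L) (map-comb _ rescale (λ { (d , i) → scale-scale c d _ }) L))
    where
    rescale : ℚ × Idx n → ℚ × Idx n
    rescale (d , i) = (c * d , i)

  InSpan-wordMul : ∀ u {p : Poly n} → InSpan n p → InSpan n (wordMul u p)
  InSpan-wordMul u {p} (spanned L basis p≈L) =
    spanned (map shift L) (All.map⁺ basis)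
      (≈-≡ {p = wordMul u p} (wordMul-≈ u {p} {comb n L} p≈L) (map-comb _ shift shift-term L))
    where
    shift : ℚ × Idx n → ℚ × Idx n
    shift (d , v , A) = (d , u ++ v , A)
    shift-term : ∀ ci → wordMul u (term ci) ≡ term (shift ci)
    shift-term (d , v , A) = trans (wordMul-scale u d (wordMul v (mA n A))) (cong (scale d) (wordMul-wordMul u v (mA n A)))

  InSpan-concatMap : ∀ {A : Set} (g : A → Poly n) xs → (∀ x → x ∈ xs → InSpan n (g x)) → InSpan n (concatMap g xs)
  InSpan-concatMap g [] _ = InSpan-[]
  InSpan-concatMap g (x ∷ xs) h = InSpan-++ (h x (here refl)) (InSpan-concatMap g xs (λ y y∈ → h y (there y∈)))

  InSpan-*ₚ : ∀ p {q : Poly n} → InSpan n q → InSpan n (p *ₚ q)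
  InSpan-*ₚ [] _ = InSpan-[]
  InSpan-*ₚ ((c , u) ∷ p) {q} q∈S =
    subst (InSpan n) (sym (*ₚ-∷ c u p q)) (InSpan-++ (InSpan-scale c (InSpan-wordMul u q∈S)) (InSpan-*ₚ p q∈S))

  InSpan-basisElt : ∀ i → IsBasisIndex n i → InSpan n (basisElt n i)
  InSpan-basisElt i isBasis =
    spanned [ (1ℚ , i) ] (isBasis ∷ []) (≈-reflexive (sym (trans (List.++-identityʳ _) (scale-1 (basisElt n i)))))

-- Equality patterns and standardisation

Concordant : ∀ {X Y : Set} → X × Y → X × Y → Set
Concordant (x , a) (y , b) = (x ≡ y → a ≡ b) × (a ≡ b → x ≡ y)

infix 4 _≍_

-- zip truncates, so lengths have to be related separately.
_≍_ : ∀ {X Y : Set} → List X → List Y → Set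
xs ≍ ys = AllPairs Concordant (zip xs ys)

module _ {X Y : Set} where

  Concordant-refl : ∀ {p : X × Y} → Concordant p p
  Concordant-refl = (λ _ → refl) , (λ _ → refl)

  Concordant-sym : ∀ {p q : X × Y} → Concordant p q → Concordant q p
  Concordant-sym (⇒ , ⇐) = sym ∘ ⇒ ∘ sym , sym ∘ ⇐ ∘ sym

  Coherent : List (X × Y) → Set
  Coherent ps = ∀ {p q} → p ∈ ps → q ∈ ps → Concordant p q

  AllPairs⇒Coherent : ∀ {ps} → AllPairs Concordant ps → Coherent ps
  AllPairs⇒Coherent (_ ∷ _)  (here refl) (here refl) = Concordant-refl
  AllPairs⇒Coherent (c ∷ _)  (here refl) (there q∈)  = All.lookup c q∈
  AllPairs⇒Coherent (c ∷ _)  (there p∈)  (here refl) = Concordant-sym (All.lookup c p∈)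
  AllPairs⇒Coherent (_ ∷ cs) (there p∈)  (there q∈)  = AllPairs⇒Coherent cs p∈ q∈

  Coherent-⊆ : ∀ {ps qs} → (∀ {p} → p ∈ ps → p ∈ qs) → Coherent qs → Coherent ps
  Coherent-⊆ ps⊆qs coh p∈ q∈ = coh (ps⊆qs p∈) (ps⊆qs q∈)

  Coherent⇒AllPairs : ∀ ps → Coherent ps → AllPairs Concordant ps
  Coherent⇒AllPairs [] _ = []
  Coherent⇒AllPairs (p ∷ ps) coh =
    All.tabulate (coh (here refl) ∘ there) ∷ Coherent⇒AllPairs ps (λ p∈ q∈ → coh (there p∈) (there q∈))

  ≍-sym : ∀ {xs : List X} {ys : List Y} → xs ≍ ys → ys ≍ xs
  ≍-sym {xs} {ys} xs≍ys =
    subst (AllPairs Concordant) (sym (List.zip-flip ys xs)) (AllPairs.map⁺ (AllPairs.map flip xs≍ys))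
    where
    flip : ∀ {p q : X × Y} → Concordant p q → Concordant (swap p) (swap q)
    flip (⇒ , ⇐) = ⇐ , ⇒

  ≍-take : ∀ k {xs : List X} {ys : List Y} → xs ≍ ys → take k xs ≍ take k ys
  ≍-take k {xs} {ys} xs≍ys = subst (AllPairs Concordant) (sym (zip-take k xs ys)) (AllPairs.take⁺ k xs≍ys)
    where
    zip-take : ∀ k (xs : List X) (ys : List Y) → zip (take k xs) (take k ys) ≡ take k (zip xs ys)
    zip-take zero xs ys = refl
    zip-take (suc k) [] ys = refl
    zip-take (suc k) (x ∷ xs) [] = refl
    zip-take (suc k) (x ∷ xs) (y ∷ ys) = cong ((x , y) ∷_) (zip-take k xs ys)

  ≍-drop : ∀ k {xs : List X} {ys : List Y} → xs ≍ ys → drop k xs ≍ drop k ys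
  ≍-drop k {xs} {ys} xs≍ys = subst (AllPairs Concordant) (sym (zip-drop k xs ys)) (AllPairs.drop⁺ k xs≍ys)
    where
    zip-drop : ∀ k (xs : List X) (ys : List Y) → zip (drop k xs) (drop k ys) ≡ drop k (zip xs ys)
    zip-drop zero xs ys = refl
    zip-drop (suc k) [] [] = refl
    zip-drop (suc k) [] (y ∷ ys) = refl
    zip-drop (suc k) (x ∷ xs) [] = List.zipWith-zeroʳ _ (drop k xs)
    zip-drop (suc k) (x ∷ xs) (y ∷ ys) = zip-drop k xs ys

≍-map : ∀ {X Y : Set} {f : X → Y} → (∀ {x y} → f x ≡ f y → x ≡ y) → (xs : List X) → map f xs ≍ xs
≍-map f-inj [] = []
≍-map {f = f} f-inj (x ∷ xs) = concordant xs ∷ ≍-map f-inj xs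
  where
  concordant : ∀ ys → All (Concordant (f x , x)) (zip (map f ys) ys)
  concordant [] = []
  concordant (y ∷ ys) = (f-inj , cong f) ∷ concordant ys

≍-refl : ∀ {X : Set} (xs : List X) → xs ≍ xs
≍-refl xs = subst (_≍ xs) (List.map-id xs) (≍-map id xs)

≍-trans : ∀ {X Y Z : Set} {xs : List X} {ys : List Y} {zs : List Z} →
          length xs ≡ length ys → length ys ≡ length zs → xs ≍ ys → ys ≍ zs → xs ≍ zs
≍-trans {xs = []} {[]} {[]} _ _ _ _ = []
≍-trans {xs = x ∷ xs} {y ∷ ys} {z ∷ zs} |xs| |ys| (c ∷ cs) (d ∷ ds) =
  compose xs ys zs |xs|′ |ys|′ c d ∷ ≍-trans |xs|′ |ys|′ cs ds
  where
  |xs|′ = ℕ.suc-injective |xs|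
  |ys|′ = ℕ.suc-injective |ys|
  compose : ∀ xs ys zs → length xs ≡ length ys → length ys ≡ length zs →
            All (Concordant (x , y)) (zip xs ys) → All (Concordant (y , z)) (zip ys zs) → All (Concordant (x , z)) (zip xs zs)
  compose [] [] [] _ _ _ _ = []
  compose (_ ∷ xs) (_ ∷ ys) (_ ∷ zs) |xs| |ys| ((⇒ , ⇐) ∷ c) ((⇒′ , ⇐′) ∷ d) =
    (⇒′ ∘ ⇒ , ⇐ ∘ ⇐′) ∷ compose xs ys zs (ℕ.suc-injective |xs|) (ℕ.suc-injective |ys|) c d

-- Letters are labelled in order of first occurrence; the dictionary records the labels given so far.
module Standardisation {X : Set} (_≟X_ : DecidableEquality X) where

  Dictionary : Set
  Dictionary = List (X × ℕ)

  record Labelling (d : Dictionary) : Set where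
    field
      label<   : ∀ {x a} → (x , a) ∈ d → a < length d
      labelled : ∀ a → a < length d → ∃ λ x → (x , a) ∈ d
  open Labelling public

  labelOf : Dictionary → X → Maybe ℕ
  labelOf [] x = nothing
  labelOf ((y , a) ∷ d) x with x ≟X y
  ... | yes _ = just a
  ... | no _  = labelOf d x

  labelOf-just : ∀ d x {a} → labelOf d x ≡ just a → (x , a) ∈ d
  labelOf-just ((y , b) ∷ d) x eq with x ≟X y
  labelOf-just ((y , b) ∷ d) x refl | yes refl = here refl
  ... | no _ = there (labelOf-just d x eq)

  labelOf-nothing : ∀ d x → labelOf d x ≡ nothing → ∀ a → (x , a) ∉ d
  labelOf-nothing ((y , b) ∷ d) x eq a x∈ with x ≟X y
  labelOf-nothing ((y , b) ∷ d) x () a x∈ | yes _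
  labelOf-nothing ((y , b) ∷ d) x eq a (here refl) | no x≢y = x≢y refl
  labelOf-nothing ((y , b) ∷ d) x eq a (there x∈) | no _ = labelOf-nothing d x eq a x∈

  insert : Dictionary → X → Dictionary
  insert d x = d ++ [ (x , length d) ]

  length-insert : ∀ d x → length (insert d x) ≡ suc (length d)
  length-insert d x = trans (List.length-++ d) (ℕ.+-comm (length d) 1)

  relabel : Dictionary → List X → List ℕ
  relabel d [] = []
  relabel d (x ∷ xs) with labelOf d x
  ... | just a  = a ∷ relabel d xs
  ... | nothing = length d ∷ relabel (insert d x) xs

  std : List X → List ℕ
  std = relabel []

  insert-invariant : ∀ d x → Coherent d → Labelling d → (∀ a → (x , a) ∉ d) →
                     Coherent (insert d x) × Labelling (insert d x)
  insert-invariant d x coh lab x∉ = coh′ , record { label< = label<′ ; labelled = labelled′ }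
    where
    new : ∀ {p} → p ∈ d → Concordant p (x , length d)
    new {y , b} p∈ = (λ { refl → ⊥-elim (x∉ b p∈) }) , (λ { refl → ⊥-elim (ℕ.<-irrefl refl (label< lab p∈)) })
    coh′ : Coherent (insert d x)
    coh′ p∈ q∈ with ∈-++-[ _ ]⁻ d p∈ | ∈-++-[ _ ]⁻ d q∈
    ... | inj₁ p∈d  | inj₁ q∈d  = coh p∈d q∈d
    ... | inj₁ p∈d  | inj₂ refl = new p∈d
    ... | inj₂ refl | inj₁ q∈d  = Concordant-sym (new q∈d)
    ... | inj₂ refl | inj₂ refl = Concordant-refl
    label<′ : ∀ {y a} → (y , a) ∈ insert d x → a < length (insert d x)
    label<′ p∈ rewrite length-insert d x with ∈-++-[ _ ]⁻ d p∈
    ... | inj₁ p∈d  = ℕ.m<n⇒m<1+n (label< lab p∈d)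
    ... | inj₂ refl = ℕ.n<1+n _
    labelled′ : ∀ a → a < length (insert d x) → ∃ λ y → (y , a) ∈ insert d x
    labelled′ a a< rewrite length-insert d x with ℕ.m≤n⇒m<n∨m≡n (ℕ.≤-pred a<)
    ... | inj₁ a<|d| = proj₁ (labelled lab a a<|d|) , ∈.∈-++⁺ˡ (proj₂ (labelled lab a a<|d|))
    ... | inj₂ refl  = x , ∈.∈-++⁺ʳ d (here refl)

  relabel-length : ∀ d xs → length (relabel d xs) ≡ length xs
  relabel-length d [] = refl
  relabel-length d (x ∷ xs) with labelOf d x
  ... | just a  = cong suc (relabel-length d xs)
  ... | nothing = cong suc (relabel-length (insert d x) xs)

  relabel-sound : ∀ d xs → Coherent d → Labelling d →
                  RGF (length d) (relabel d xs) × Coherent (d ++ zip xs (relabel d xs))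
  relabel-sound d [] coh lab = [] , Coherent-⊆ (subst (_ ∈_) (List.++-identityʳ d)) coh
  relabel-sound d (x ∷ xs) coh lab with labelOf d x in eq
  ... | just a =
    ℕ.<⇒≤ a< ∷ subst (λ k → RGF k (relabel d xs)) (sym (ℕ.m≥n⇒m⊔n≡m a<)) (proj₁ IH) , Coherent-⊆ old (proj₂ IH)
    where
    IH = relabel-sound d xs coh lab
    xa∈ = labelOf-just d x eq
    a< = label< lab xa∈
    old : ∀ {p} → p ∈ d ++ (x , a) ∷ zip xs (relabel d xs) → p ∈ d ++ zip xs (relabel d xs)
    old p∈ with ∈.∈-++⁻ d p∈
    ... | inj₁ p∈d = ∈.∈-++⁺ˡ p∈d
    ... | inj₂ (here refl) = ∈.∈-++⁺ˡ xa∈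
    ... | inj₂ (there p∈) = ∈.∈-++⁺ʳ d p∈
  ... | nothing =
    ℕ.≤-refl ∷ subst (λ k → RGF k (relabel (insert d x) xs)) |d′| (proj₁ IH) ,
    subst Coherent (List.++-assoc d [ (x , length d) ] _) (proj₂ IH)
    where
    inv = insert-invariant d x coh lab (labelOf-nothing d x eq)
    IH = relabel-sound (insert d x) xs (proj₁ inv) (proj₂ inv)
    |d′| : length (insert d x) ≡ length d ⊔ suc (length d)
    |d′| = trans (length-insert d x) (sym (ℕ.m≤n⇒m⊔n≡n (ℕ.n≤1+n _)))

  relabel-unique : ∀ d xs A → Coherent (d ++ zip xs A) → Labelling d → RGF (length d) A → length A ≡ length xs →
                   relabel d xs ≡ A
  relabel-unique d [] [] _ _ _ _ = refl
  relabel-unique d (x ∷ xs) (a ∷ A) coh lab (a≤ ∷ rgf) |A| with labelOf d x in eq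
  ... | just b = cong₂ _∷_ b≡a (relabel-unique d xs A (Coherent-⊆ skip coh) lab rgf′ (ℕ.suc-injective |A|))
    where
    xb∈ = labelOf-just d x eq
    b≡a : b ≡ a
    b≡a = proj₁ (coh (∈.∈-++⁺ˡ xb∈) (∈.∈-++⁺ʳ d (here refl))) refl
    skip : ∀ {p} → p ∈ d ++ zip xs A → p ∈ d ++ (x , a) ∷ zip xs A
    skip p∈ with ∈.∈-++⁻ d p∈
    ... | inj₁ p∈d = ∈.∈-++⁺ˡ p∈d
    ... | inj₂ p∈  = ∈.∈-++⁺ʳ d (there p∈)
    rgf′ : RGF (length d) A
    rgf′ = subst (λ k → RGF k A) (ℕ.m≥n⇒m⊔n≡m (subst (_< length d) b≡a (label< lab xb∈))) rgf
  ... | nothing = cong₂ _∷_ (sym a≡|d|) (relabel-unique (insert d x) xs A coh′ (proj₂ inv) rgf′ (ℕ.suc-injective |A|))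
    where
    x∉ = labelOf-nothing d x eq
    a≡|d| : a ≡ length d
    a≡|d| with ℕ.m≤n⇒m<n∨m≡n a≤
    ... | inj₂ a≡ = a≡
    ... | inj₁ a< = ⊥-elim (x∉ a (subst (λ y → (y , a) ∈ d) y≡x y∈))
      where
      y∈ = proj₂ (labelled lab a a<)
      y≡x = proj₂ (coh (∈.∈-++⁺ˡ y∈) (∈.∈-++⁺ʳ d (here refl))) refl
    inv = insert-invariant d x (Coherent-⊆ ∈.∈-++⁺ˡ coh) lab x∉
    coh′ : Coherent (insert d x ++ zip xs A)
    coh′ = subst Coherent (sym (List.++-assoc d [ (x , length d) ] (zip xs A)))
                 (subst (λ b → Coherent (d ++ (x , b) ∷ zip xs A)) a≡|d| coh)
    rgf′ : RGF (length (insert d x)) A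
    rgf′ = subst (λ k → RGF k A) (trans (cong (λ b → length d ⊔ suc b) a≡|d|)
                                        (trans (ℕ.m≤n⇒m⊔n≡n (ℕ.n≤1+n _)) (sym (length-insert d x)))) rgf

  empty-coherent : Coherent {X} {ℕ} []
  empty-coherent ()

  empty-labelling : Labelling []
  empty-labelling = record { label< = λ () ; labelled = λ _ () }

  std-length : ∀ xs → length (std xs) ≡ length xs
  std-length = relabel-length []

  std-isSetPartition : ∀ xs → IsSetPartition (std xs)
  std-isSetPartition xs = proj₁ (relabel-sound [] xs empty-coherent empty-labelling)

  std-≍ : ∀ xs → xs ≍ std xs
  std-≍ xs = Coherent⇒AllPairs _ (proj₂ (relabel-sound [] xs empty-coherent empty-labelling))

  std-unique : ∀ xs A → IsSetPartition A → length A ≡ length xs → xs ≍ A → std xs ≡ A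
  std-unique xs A rgf |A| xs≍A = relabel-unique [] xs A (AllPairs⇒Coherent xs≍A) empty-labelling rgf |A|

module W {n : ℕ} = Standardisation (_≟F_ {n})
module N = Standardisation _≟ℕ_

std-≍-invariant : ∀ {X Y : Set} (_≟X_ : DecidableEquality X) (_≟Y_ : DecidableEquality Y) (xs : List X) (ys : List Y) →
                  length xs ≡ length ys → xs ≍ ys → Standardisation.std _≟X_ xs ≡ Standardisation.std _≟Y_ ys
std-≍-invariant _≟X_ _≟Y_ xs ys |xs| xs≍ys =
  sym (Y.std-unique ys (X.std xs) (X.std-isSetPartition xs) (trans (X.std-length xs) |xs|)
        (≍-trans (sym |xs|) (sym (X.std-length xs)) (≍-sym xs≍ys) (X.std-≍ xs)))
  where
  module X = Standardisation _≟X_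
  module Y = Standardisation _≟Y_

std-take : ∀ {n} k (w : Word n) → W.std (take k w) ≡ take k (W.std w)
std-take k w = W.std-unique (take k w) (take k (W.std w)) (RGF-take k _ (W.std-isSetPartition w))
  (trans (List.length-take k (W.std w)) (trans (cong (k ⊓_) (W.std-length w)) (sym (List.length-take k w))))
  (≍-take k (W.std-≍ w))

std-drop : ∀ {n} k (w : Word n) → N.std (drop k (W.std w)) ≡ W.std (drop k w)
std-drop k w = std-≍-invariant _≟ℕ_ _≟F_ (drop k (W.std w)) (drop k w)
  (trans (List.length-drop k (W.std w)) (trans (cong (_∸ k) (W.std-length w)) (sym (List.length-drop k w))))
  (≍-drop k (≍-sym (W.std-≍ w)))

std-toℕ : ∀ {n} (w : Word n) → N.std (map toℕ w) ≡ W.std w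
std-toℕ w = std-≍-invariant _≟ℕ_ _≟F_ (map toℕ w) w (List.length-map toℕ w) (≍-map Fin.toℕ-injective w)

std-setPartition : ∀ A → IsSetPartition A → N.std A ≡ A
std-setPartition A rgf = N.std-unique A A rgf refl (≍-refl A)

module _ where
  open N

  -- While every letter labelled so far is its own label, the labels below |d| are taken,
  -- so the fresh label |d| is at most the fresh letter.
  relabel-≤lex : ∀ d y → (∀ {x a} → (x , a) ∈ d → x ≡ a) → Coherent d → Labelling d → relabel d y ≤lex y
  relabel-≤lex d [] _ _ _ = inj₂ refl
  relabel-≤lex d (x ∷ y) self coh lab with labelOf d x in eq
  ... | just a with self (labelOf-just d x eq)
  ...   | refl = ∷-≤lex x (relabel-≤lex d y self coh lab)
  relabel-≤lex d (x ∷ y) self coh lab | nothing with ℕ.<-cmp (length d) x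
  ... | tri< |d|<x _ _ = inj₁ (here |d|<x (relabel-length (insert d x) y))
  ... | tri> _ _ x<|d| = ⊥-elim (labelOf-nothing d x eq x (subst (λ z → (z , x) ∈ d) (self x′∈) x′∈))
    where x′∈ = proj₂ (labelled lab x x<|d|)
  ... | tri≈ _ refl _ = ∷-≤lex x (relabel-≤lex (insert d x) y self′ (proj₁ inv) (proj₂ inv))
    where
    inv = insert-invariant d x coh lab (labelOf-nothing d x eq)
    self′ : ∀ {z a} → (z , a) ∈ insert d x → z ≡ a
    self′ p∈ with ∈-++-[ _ ]⁻ d p∈
    ... | inj₁ p∈d  = self p∈d
    ... | inj₂ refl = refl

  std-≤lex : ∀ y → std y ≤lex y
  std-≤lex y = relabel-≤lex [] y (λ ()) empty-coherent empty-labelling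

module _ {n : ℕ} where
  open Standardisation (_≟F_ {n})

  dictionary-bound : ∀ d → Coherent d → Labelling d → length d ≤ n
  dictionary-bound d coh lab with length d ℕ.≤? n
  ... | yes |d|≤n = |d|≤n
  ... | no |d|≰n = ⊥-elim (collision (Fin.pigeonhole (ℕ.≰⇒> |d|≰n) letter))
    where
    letter : Fin (length d) → Fin n
    letter i = proj₁ (labelled lab (toℕ i) (Fin.toℕ<n i))
    letter∈ : ∀ i → (letter i , toℕ i) ∈ d
    letter∈ i = proj₂ (labelled lab (toℕ i) (Fin.toℕ<n i))
    collision : ¬ ∃₂ λ i j → i <F j × letter i ≡ letter j
    collision (i , j , i<j , eq) = ℕ.<-irrefl (proj₁ (coh (letter∈ i) (letter∈ j)) eq) i<j

  relabel-bound : ∀ d xs → Coherent d → Labelling d → All (_< n) (relabel d xs)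
  relabel-bound d [] coh lab = []
  relabel-bound d (x ∷ xs) coh lab with labelOf d x in eq
  ... | just a  = ℕ.<-≤-trans (label< lab (labelOf-just d x eq)) (dictionary-bound d coh lab) ∷ relabel-bound d xs coh lab
  ... | nothing = ℕ.<-≤-trans (subst (length d <_) (sym (length-insert d x)) (ℕ.n<1+n _))
                              (dictionary-bound (insert d x) (proj₁ inv) (proj₂ inv))
                  ∷ relabel-bound (insert d x) xs (proj₁ inv) (proj₂ inv)
    where inv = insert-invariant d x coh lab (labelOf-nothing d x eq)

  std-bound : ∀ (w : Word n) → All (_< n) (std w)
  std-bound w = relabel-bound [] w empty-coherent empty-labelling

ℓ-std : ∀ {n} (w : Word n) → ℓ (W.std w) ≤ n
ℓ-std w = All<⇒ℓ≤ (W.std w) (std-bound w)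

-- Coefficients of m_A

∑-branches : ∀ {A : Set} (F : List A → ℚ) (T : A → List (List A)) hs h → Unique hs → h ∈ hs →
             (∀ a → a ≢ h → ∀ v → F (a ∷ v) ≡ 0ℚ) →
             ∑ F (concatMap (λ a → map (a ∷_) (T a)) hs) ≡ ∑ (F ∘ (h ∷_)) (T h)
∑-branches F T hs h unique h∈ F0 = begin
  ∑ F (concatMap (λ a → map (a ∷_) (T a)) hs)   ≡⟨ ∑-concatMap F _ hs ⟩
  ∑ (λ a → ∑ F (map (a ∷_) (T a))) hs           ≡⟨ ∑-cong hs (λ a _ → ∑-map F (a ∷_) (T a)) ⟩
  ∑ (λ a → ∑ (F ∘ (a ∷_)) (T a)) hs             ≡⟨ ∑-point hs unique h∈ (λ a a≢h → ∑-zero (T a) (λ v _ → F0 a a≢h v)) ⟩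
  ∑ (F ∘ (h ∷_)) (T h)                          ∎
  where open ≡-Reasoning

∑-allWords : ∀ {n} m (w : Word n) F → length w ≡ m → (∀ v → v ≢ w → F v ≡ 0ℚ) → ∑ F (allWords n m) ≡ F w
∑-allWords zero [] F _ _ = ℚ.+-identityʳ (F [])
∑-allWords {n} (suc m) (x ∷ w) F |w| F0 =
  trans (∑-branches F (λ _ → allWords n m) (allFin n) x (Unique.allFin⁺ n) (∈.∈-allFin x)
                    (λ a a≢x v → F0 (a ∷ v) (a≢x ∘ List.∷-injectiveˡ)))
        (∑-allWords m w (F ∘ (x ∷_)) (ℕ.suc-injective |w|) (λ v v≢w → F0 (x ∷ v) (v≢w ∘ List.∷-injectiveʳ)))

allWords-length : ∀ n m → All (λ v → length v ≡ m) (allWords n m)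
allWords-length n zero = refl ∷ []
allWords-length n (suc m) =
  All.concat⁺ (All.map⁺ (All.universal (λ _ → All.map⁺ (All.map (cong suc) (allWords-length n m))) (allFin n)))

rgfs : ℕ → ℕ → List (List ℕ)
rgfs k zero = [ [] ]
rgfs k (suc m) = concatMap (λ a → map (a ∷_) (rgfs (k ⊔ suc a) m)) (upTo (suc k))

∑-rgfs : ∀ k m D F → RGF k D → length D ≡ m → (∀ v → v ≢ D → F v ≡ 0ℚ) → ∑ F (rgfs k m) ≡ F D
∑-rgfs k zero [] F _ _ _ = ℚ.+-identityʳ (F [])
∑-rgfs k (suc m) (a ∷ D) F (a≤k ∷ rgf) |D| F0 =
  trans (∑-branches F (λ b → rgfs (k ⊔ suc b) m) (upTo (suc k)) a (Unique.upTo⁺ (suc k)) (∈.∈-upTo⁺ (s≤s a≤k))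
                    (λ b b≢a v → F0 (b ∷ v) (b≢a ∘ List.∷-injectiveˡ)))
        (∑-rgfs (k ⊔ suc a) m D (F ∘ (a ∷_)) rgf (ℕ.suc-injective |D|) (λ v v≢D → F0 (a ∷ v) (v≢D ∘ List.∷-injectiveʳ)))

rgfs-sound : ∀ k m → All (λ D → RGF k D × length D ≡ m) (rgfs k m)
rgfs-sound k zero = ([] , refl) ∷ []
rgfs-sound k (suc m) = All.concat⁺ (All.map⁺ (All.map extend (All.all-upTo (suc k))))
  where
  extend : ∀ {a} → a < suc k → All (λ D → RGF k D × length D ≡ suc m) (map (a ∷_) (rgfs (k ⊔ suc a) m))
  extend a<1+k = All.map⁺ (All.map (λ (rgf , |D|) → (ℕ.≤-pred a<1+k ∷ rgf) , cong suc |D|) (rgfs-sound _ m))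

∑-rgfs-𝟙 : ∀ m s {Q : List ℕ → Set} (Q? : ∀ E → Dec (Q E)) → IsSetPartition s → (Q s → length s ≡ m) →
           ∑ (λ E → 𝟙 (s ≟L E)) (filter Q? (rgfs 0 m)) ≡ 𝟙 (Q? s)
∑-rgfs-𝟙 m s {Q} Q? rgf |s| = trans (∑-filter Q? _ (rgfs 0 m)) (count (Q? s))
  where
  F : List ℕ → ℚ
  F E = if does (Q? E) then 𝟙 (s ≟L E) else 0ℚ
  F0 : ∀ E → E ≢ s → F E ≡ 0ℚ
  F0 E E≢s = trans (cong (λ z → if does (Q? E) then z else 0ℚ) (𝟙-no (s ≟L E) (E≢s ∘ sym))) (if-0 _)
  Fs : F s ≡ 𝟙 (Q? s)
  Fs = cong (λ z → if does (Q? s) then z else 0ℚ) (𝟙-yes (s ≟L s) refl)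
  count : Dec (Q s) → ∑ F (rgfs 0 m) ≡ 𝟙 (Q? s)
  count (yes q) = trans (∑-rgfs 0 m s F rgf (|s| q) F0) Fs
  count (no ¬q) = trans (∑-zero (rgfs 0 m) (λ E _ → F≡0 E)) (sym (𝟙-no (Q? s) ¬q))
    where
    F≡0 : ∀ E → F E ≡ 0ℚ
    F≡0 E with E ≟L s
    ... | yes refl = trans Fs (𝟙-no (Q? s) ¬q)
    ... | no E≢s   = F0 E E≢s

module _ {n : ℕ} where

  private
    ∧-true : ∀ {a b} → a ∧ b ≡ true → a ≡ true × b ≡ true
    ∧-true {true} {true} _ = refl , refl

  concordant-agree : ∀ (x y : Fin n) a b → (⌊ x ≟F y ⌋ ==ᵇ (a ≡ᵇ b)) ≡ true → Concordant (x , a) (y , b)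
  concordant-agree x y a b h with x ≟F y | a ≡ᵇ b in eq
  ... | yes x≡y | true  = (λ _ → ℕ.≡ᵇ⇒≡ a b (subst T (sym eq) _)) , (λ _ → x≡y)
  ... | no x≢y  | false = (⊥-elim ∘ x≢y) , (λ a≡b → ⊥-elim (subst T eq (ℕ.≡⇒≡ᵇ a b a≡b)))

  agree-concordant : ∀ (x y : Fin n) a b → Concordant (x , a) (y , b) → (⌊ x ≟F y ⌋ ==ᵇ (a ≡ᵇ b)) ≡ true
  agree-concordant x y a b (⇒ , ⇐) with x ≟F y | a ≡ᵇ b in eq
  ... | yes _   | true  = refl
  ... | no _    | false = refl
  ... | yes x≡y | false = ⊥-elim (subst T eq (ℕ.≡⇒≡ᵇ a b (⇒ x≡y)))
  ... | no x≢y  | true  = ⊥-elim (x≢y (⇐ (ℕ.≡ᵇ⇒≡ a b (subst T (sym eq) _))))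

  agree⇒AllPairs : ∀ (ps : List (Fin n × ℕ)) → agree ps ≡ true → AllPairs Concordant ps
  agree⇒AllPairs [] _ = []
  agree⇒AllPairs ((x , a) ∷ ps) h = all ps (proj₁ (∧-true h)) ∷ agree⇒AllPairs ps (proj₂ (∧-true h))
    where
    all : ∀ qs → allᵇ _ qs ≡ true → All (Concordant (x , a)) qs
    all [] _ = []
    all ((y , b) ∷ qs) h = concordant-agree x y a b (proj₁ (∧-true h)) ∷ all qs (proj₂ (∧-true h))

  AllPairs⇒agree : ∀ (ps : List (Fin n × ℕ)) → AllPairs Concordant ps → agree ps ≡ true
  AllPairs⇒agree [] _ = refl
  AllPairs⇒agree ((x , a) ∷ ps) (c ∷ cs) = cong₂ _∧_ (all ps c) (AllPairs⇒agree ps cs)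
    where
    all : ∀ qs → All (Concordant (x , a)) qs → allᵇ _ qs ≡ true
    all [] _ = refl
    all ((y , b) ∷ qs) (c ∷ cs) = cong₂ _∧_ (agree-concordant x y a b c) (all qs cs)

  agree-std : ∀ (w : Word n) A → IsSetPartition A → length w ≡ length A → agree (zip w A) ≡ does (W.std w ≟L A)
  agree-std w A rgf |w| with agree (zip w A) in eq
  ... | true  = sym (dec-true (W.std w ≟L A) (W.std-unique w A rgf (sym |w|) (agree⇒AllPairs (zip w A) eq)))
  ... | false = sym (dec-false (W.std w ≟L A) λ std≡A → false≢true
                  (trans (sym eq) (AllPairs⇒agree (zip w A) (subst (w ≍_) std≡A (W.std-≍ w)))))
    where
    false≢true : false ≢ true
    false≢true ()

  coeff-units : ∀ (ws : List (Word n)) w → coeff (map (λ v → (1ℚ , v)) ws) w ≡ ∑ (λ v → 𝟙 (v ≟W w)) ws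
  coeff-units [] w = refl
  coeff-units (v ∷ ws) w =
    trans (coeff-∷ 1ℚ v _ w) (cong₂ _+_ (ℚ.*-identityˡ (𝟙 (v ≟W w))) (coeff-units ws w))

  coeff-mA : ∀ A (w : Word n) → IsSetPartition A → coeff (mA n A) w ≡ 𝟙 (W.std w ≟L A)
  coeff-mA A w rgf = begin
    coeff (mA n A) w
      ≡⟨ coeff-units patternWords w ⟩
    ∑ (λ v → 𝟙 (v ≟W w)) patternWords
      ≡⟨ ∑-filter _ _ (allWords n (length A)) ⟩
    ∑ F (allWords n (length A))
      ≡⟨ sum (length w ℕ.≟ length A) ⟩
    𝟙 (W.std w ≟L A)
      ∎
    where
    open ≡-Reasoning
    patternWords = filterᵇ (λ v → agree (zip v A)) (allWords n (length A))
    F : Word n → ℚ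
    F v = if agree (zip v A) then 𝟙 (v ≟W w) else 0ℚ
    F0 : ∀ v → v ≢ w → F v ≡ 0ℚ
    F0 v v≢w = trans (cong (λ z → if agree (zip v A) then z else 0ℚ) (𝟙-no (v ≟W w) v≢w)) (if-0 _)
    sum : Dec (length w ≡ length A) → ∑ F (allWords n (length A)) ≡ 𝟙 (W.std w ≟L A)
    sum (yes |w|) = begin
      ∑ F (allWords n (length A))
        ≡⟨ ∑-allWords (length A) w F |w| F0 ⟩
      (if agree (zip w A) then 𝟙 (w ≟W w) else 0ℚ)
        ≡⟨ cong (λ z → if agree (zip w A) then z else 0ℚ) (𝟙-yes (w ≟W w) refl) ⟩
      (if agree (zip w A) then 1ℚ else 0ℚ)
        ≡⟨ cong (λ b → if b then 1ℚ else 0ℚ) (agree-std w A rgf |w|) ⟩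
      𝟙 (W.std w ≟L A)
        ∎
    sum (no |w|≢) = trans (∑-zero _ (λ v v∈ → F0 v (λ { refl → |w|≢ (All.lookup (allWords-length n (length A)) v∈) })))
                          (sym (𝟙-no (W.std w ≟L A) (|w|≢ ∘ trans (sym (W.std-length w)) ∘ cong length)))

  mA-homogeneous : ∀ A → Homogeneous (length A) (mA n A)
  mA-homogeneous A = All.map⁺ (All.filter⁺ _ (allWords-length n (length A)))

-- Unique factorisation

InC-suffix : ∀ {n} (v v′ s : Word n) → InC n v → InC n v′ → v ≡ s ++ v′ → s ≡ []
InC-suffix v v′ [] _ _ _ = refl
InC-suffix v v′ (x ∷ s) (A , rgf , nonsplit , A<n , refl) (A′ , rgf′ , nonsplit′ , A′<n , refl) v≡ =
  ⊥-elim (proj₂ nonsplit (B , A′ , RGF-++ˡ B A′ (subst IsSetPartition A≡ rgf) , rgf′ , (λ ()) , proj₁ nonsplit′ , A≡))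
  where
  B = map toℕ (x ∷ s)
  A≡ : A ≡ B ++ A′
  A≡ = begin
    A                                              ≡⟨ sym (toℕ-LT-mA A A<n) ⟩
    map toℕ (LT-mA A A<n)                          ≡⟨ cong (map toℕ) v≡ ⟩
    map toℕ (x ∷ s ++ LT-mA A′ A′<n)               ≡⟨ List.map-++ toℕ (x ∷ s) _ ⟩
    map toℕ (x ∷ s) ++ map toℕ (LT-mA A′ A′<n)     ≡⟨ cong (map toℕ (x ∷ s) ++_) (toℕ-LT-mA A′ A′<n) ⟩
    map toℕ (x ∷ s) ++ A′                          ∎
    where open ≡-Reasoning

factorisation-unique : ∀ {n} (u v u′ v′ : Word n) → InC n v → InC n v′ → u ++ v ≡ u′ ++ v′ → u ≡ u′ × v ≡ v′
factorisation-unique u v u′ v′ v∈C v′∈C eq with ++-split u v u′ v′ eq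
... | inj₁ (s , u′≡ , v≡) with InC-suffix v v′ s v∈C v′∈C v≡
...   | refl = sym (trans u′≡ (List.++-identityʳ u)) , v≡
factorisation-unique u v u′ v′ v∈C v′∈C eq | inj₂ (s , u≡ , v′≡) with InC-suffix v′ v s v′∈C v∈C v′≡
...   | refl = trans u≡ (List.++-identityʳ u′) , sym v′≡

uniqueFactorisation : ∀ n → UniqueFactorisation n
uniqueFactorisation n w _ u v u′ v′ v∈C w≡uv v′∈C w≡u′v′ =
  factorisation-unique u v u′ v′ v∈C v′∈C (trans (sym w≡uv) w≡u′v′)

-- Spanning

module _ {n : ℕ} where

  mA-vanishes : ∀ D → IsSetPartition D → ¬ ℓ D ≤ n → mA n D ≈ []
  mA-vanishes D rgf ℓ≰n w =
    trans (coeff-mA D w rgf) (𝟙-no (W.std w ≟L D) λ std≡D → ℓ≰n (subst (λ E → ℓ E ≤ n) std≡D (ℓ-std w)))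

  InSpan-mA-nonsplitable : ∀ C → IsSetPartition C → Nonsplitable C → InSpan n (mA n C)
  InSpan-mA-nonsplitable C rgf nonsplit with ℓ C ℕ.≤? n
  ... | yes ℓ≤n = subst (InSpan n) (List.map-id (mA n C)) (InSpan-basisElt ([] , C) (rgf , nonsplit , ℓ≤n))
  ... | no ℓ≰n  = InSpan-≈ {p = mA n C} (mA-vanishes C rgf ℓ≰n) InSpan-[]

NoPartitionSuffix : List ℕ → Set
NoPartitionSuffix D = ∀ P C → D ≡ P ++ C → C ≢ [] → ¬ IsSetPartition C

data PartitionSuffix (D : List ℕ) : Set where
  shortest : ∀ P C → D ≡ P ++ C → IsSetPartition C → C ≢ [] →
             (∀ B C′ → C ≡ B ++ C′ → B ≢ [] → C′ ≢ [] → ¬ IsSetPartition C′) → PartitionSuffix D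
  none     : NoPartitionSuffix D → PartitionSuffix D

partitionSuffix : ∀ D → PartitionSuffix D
partitionSuffix [] = none λ P C []≡ C≢[] _ → C≢[] (List.++-conicalʳ P C (sym []≡))
partitionSuffix (a ∷ D) with partitionSuffix D
... | shortest P C D≡ rgf C≢[] minimal = shortest (a ∷ P) C (cong (a ∷_) D≡) rgf C≢[] minimal
... | none noSuffix with rgf? 0 (a ∷ D)
...   | yes rgf = shortest [] (a ∷ D) refl rgf (λ ()) minimal
  where
  minimal : ∀ B C′ → a ∷ D ≡ B ++ C′ → B ≢ [] → C′ ≢ [] → ¬ IsSetPartition C′
  minimal [] C′ _ B≢[] = ⊥-elim (B≢[] refl)
  minimal (_ ∷ B) C′ eq _ = noSuffix B C′ (List.∷-injectiveʳ eq)
...   | no ¬rgf = none noSuffix′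
  where
  noSuffix′ : NoPartitionSuffix (a ∷ D)
  noSuffix′ [] C eq _ rgf = ¬rgf (subst IsSetPartition (sym eq) rgf)
  noSuffix′ (_ ∷ P) C eq = noSuffix P C (List.∷-injectiveʳ eq)

nonsplitable-suffix : ∀ D → IsSetPartition D → D ≢ [] → ∃₂ λ P C → D ≡ P ++ C × IsSetPartition C × Nonsplitable C
nonsplitable-suffix D rgf D≢[] with partitionSuffix D
... | none noSuffix = ⊥-elim (noSuffix [] D refl D≢[] rgf)
... | shortest P C D≡ rgfC C≢[] minimal =
  P , C , D≡ , rgfC , C≢[] , λ { (B , C′ , _ , rgfC′ , B≢[] , C′≢[] , C≡) → minimal B C′ C≡ B≢[] C′≢[] rgfC′ }

module Expansion {n : ℕ} (P C : List ℕ) (rgfPC : IsSetPartition (P ++ C)) (rgfC : IsSetPartition C) where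

  rgfP : IsSetPartition P
  rgfP = RGF-++ˡ P C rgfPC

  Extends : List ℕ → Set
  Extends E = take (length P) E ≡ P × N.std (drop (length P) E) ≡ C

  extends? : ∀ E → Dec (Extends E)
  extends? E = (take (length P) E ≟L P) ×-dec (N.std (drop (length P) E) ≟L C)

  extends-self : Extends (P ++ C)
  extends-self = take-length-++ P C , trans (cong N.std (drop-length-++ P C)) (std-setPartition C rgfC)

  extends-length : ∀ E → Extends E → length E ≡ length (P ++ C)
  extends-length E (take≡P , std≡C) = begin
    length E                                ≡⟨ cong length (sym (List.take++drop≡id (length P) E)) ⟩
    length (take (length P) E ++ y)         ≡⟨ List.length-++ (take (length P) E) ⟩
    length (take (length P) E) +ℕ length y  ≡⟨ cong₂ _+ℕ_ (cong length take≡P) (sym (N.std-length y)) ⟩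
    length P +ℕ length (N.std y)            ≡⟨ cong (λ A → length P +ℕ length A) std≡C ⟩
    length P +ℕ length C                    ≡⟨ sym (List.length-++ P) ⟩
    length (P ++ C)                         ∎
    where
    open ≡-Reasoning
    y = drop (length P) E

  coeff-mA*mA : ∀ w → coeff (mA n P *ₚ mA n C) w ≡ 𝟙 (extends? (W.std w))
  coeff-mA*mA w = begin
    coeff (mA n P *ₚ mA n C) w
      ≡⟨ coeff-*ₚ (mA n P) (mA n C) w (mA-homogeneous P) ⟩
    coeff (mA n P) (take p w) * coeff (mA n C) (drop p w)
      ≡⟨ cong₂ _*_ (coeff-mA P (take p w) rgfP) (coeff-mA C (drop p w) rgfC) ⟩
    𝟙 (W.std (take p w) ≟L P) * 𝟙 (W.std (drop p w) ≟L C)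
      ≡⟨ cong₂ (λ A B → 𝟙 (A ≟L P) * 𝟙 (B ≟L C)) (std-take p w) (sym (std-drop p w)) ⟩
    𝟙 (take p (W.std w) ≟L P) * 𝟙 (N.std (drop p (W.std w)) ≟L C)
      ≡⟨ 𝟙-× (take p (W.std w) ≟L P) (N.std (drop p (W.std w)) ≟L C) ⟩
    𝟙 (extends? (W.std w))
      ∎
    where
    open ≡-Reasoning
    p = length P

  above? : ∀ E → Dec (Extends E × ¬ E ≡ P ++ C)
  above? E = extends? E ×-dec ¬? (E ≟L P ++ C)

  above : List (List ℕ)
  above = filter above? (rgfs 0 (length (P ++ C)))

  coeff-above : ∀ w → coeff (concatMap (mA n) above) w ≡ 𝟙 (above? (W.std w))
  coeff-above w = begin
    coeff (concatMap (mA n) above) w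
      ≡⟨ coeff-concatMap (mA n) above w ⟩
    ∑ (λ E → coeff (mA n E) w) above
      ≡⟨ ∑-cong above (λ E E∈ → coeff-mA E w (rgf (proj₁ (∈.∈-filter⁻ above? E∈)))) ⟩
    ∑ (λ E → 𝟙 (W.std w ≟L E)) above
      ≡⟨ ∑-rgfs-𝟙 _ (W.std w) above? (W.std-isSetPartition w) (extends-length (W.std w) ∘ proj₁) ⟩
    𝟙 (above? (W.std w))
      ∎
    where
    open ≡-Reasoning
    rgf : ∀ {E} → E ∈ rgfs 0 (length (P ++ C)) → IsSetPartition E
    rgf = proj₁ ∘ All.lookup (rgfs-sound 0 (length (P ++ C)))

  above-upper : ∀ {E} → E ∈ above → IsSetPartition E × length E ≡ length (P ++ C) × P ++ C <lex E
  above-upper {E} E∈ with ∈.∈-filter⁻ above? {xs = rgfs 0 (length (P ++ C))} E∈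
  ... | E∈rgfs , (take≡P , std≡C) , E≢PC = proj₁ rgfE , proj₂ rgfE , upper (std-≤lex y)
    where
    rgfE = All.lookup (rgfs-sound 0 _) E∈rgfs
    y = drop (length P) E
    E≡P++y : E ≡ P ++ y
    E≡P++y = trans (sym (List.take++drop≡id (length P) E)) (cong (_++ y) take≡P)
    upper : N.std y ≤lex y → P ++ C <lex E
    upper (inj₁ lt) = subst₂ _<lex_ (cong (P ++_) std≡C) (sym E≡P++y) (<lex-++ P lt)
    upper (inj₂ eq) = ⊥-elim (E≢PC (trans E≡P++y (cong (P ++_) (trans (sym eq) std≡C))))

  mA-expansion : mA n (P ++ C) ≈ (mA n P *ₚ mA n C) ++ scale (- 1ℚ) (concatMap (mA n) above)
  mA-expansion w = begin
    coeff (mA n (P ++ C)) w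
      ≡⟨ coeff-mA (P ++ C) w rgfPC ⟩
    𝟙 (s ≟L P ++ C)
      ≡⟨ 𝟙-split (extends? s) (s ≟L P ++ C) (λ s≡ → subst Extends (sym s≡) extends-self) ⟩
    𝟙 (extends? s) + - 1ℚ * 𝟙 (above? s)
      ≡⟨ sym (cong₂ _+_ (coeff-mA*mA w) (trans (coeff-scale (- 1ℚ) others w) (cong (- 1ℚ *_) (coeff-above w)))) ⟩
    coeff (mA n P *ₚ mA n C) w + coeff (scale (- 1ℚ) others) w
      ≡⟨ sym (coeff-++ (mA n P *ₚ mA n C) _ w) ⟩
    coeff ((mA n P *ₚ mA n C) ++ scale (- 1ℚ) others) w
      ∎
    where
    open ≡-Reasoning
    s = W.std w
    others = concatMap (mA n) above

μ : List ℕ → ℕ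
μ D = suc (length D) ^ length D ∸ horner (suc (length D)) D

μ-<lex : ∀ {D E} → IsSetPartition D → IsSetPartition E → length E ≡ length D → D <lex E → μ E < μ D
μ-<lex {D} {E} rgfD rgfE |E| D<E rewrite |E| =
  ℕ.∸-monoʳ-< (horner-<lex B (digits D rgfD refl) (digits E rgfE |E|) D<E)
              (ℕ.<⇒≤ (subst (λ k → horner B E < B ^ k) |E| (horner-< B E (digits E rgfE |E|))))
  where
  B = suc (length D)
  digits : ∀ A → IsSetPartition A → length A ≡ length D → All (_< B) A
  digits A rgf |A| = All.map (λ a< → ℕ.m<n⇒m<1+n (subst (_ <_) |A| a<)) (RGF-< A rgf)

module _ {n : ℕ} where

  InSpan-mA : ∀ D → IsSetPartition D → D ≢ [] → InSpan n (mA n D)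
  InSpan-mA D rgf D≢[] = go D rgf D≢[] (<-wellFounded (μ D))
    where
    go : ∀ D → IsSetPartition D → D ≢ [] → Acc _<_ (μ D) → InSpan n (mA n D)
    go D rgf D≢[] (acc smaller) with nonsplitable-suffix D rgf D≢[]
    ... | P , C , refl , rgfC , nonsplit =
      InSpan-≈ {p = mA n (P ++ C)} mA-expansion
        (InSpan-++ (InSpan-*ₚ (mA n P) (InSpan-mA-nonsplitable C rgfC nonsplit))
                   (InSpan-scale (- 1ℚ) (InSpan-concatMap (mA n) above recurse)))
      where
      open Expansion {n} P C rgf rgfC
      nonempty : ∀ {xs ys} → xs <lex ys → ys ≢ []
      nonempty (here _ _) ()
      nonempty (there _) ()
      recurse : ∀ E → E ∈ above → InSpan n (mA n E)
      recurse E E∈ with above-upper E∈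
      ... | rgfE , |E| , PC<E = go E rgfE (nonempty PC<E) (smaller (μ-<lex rgf rgfE |E| PC<E))

  -- m_A minus its constant term, which is nonzero only for m_[] = 1.
  mA⁺ : List ℕ → Poly n
  mA⁺ [] = []
  mA⁺ A@(_ ∷ _) = mA n A

  InSpan-mA⁺ : ∀ A → IsSetPartition A → InSpan n (mA⁺ A)
  InSpan-mA⁺ [] _ = InSpan-[]
  InSpan-mA⁺ A@(_ ∷ _) rgf = InSpan-mA A rgf (λ ())

  coeff-mA-[] : ∀ A → IsSetPartition A → A ≢ [] → coeff (mA n A) [] ≡ 0ℚ
  coeff-mA-[] A rgf A≢[] = trans (coeff-mA A [] rgf) (𝟙-no ([] ≟L A) (A≢[] ∘ sym))

  coeff-combination : ∀ (g : List ℕ → Poly n) (L : List (ℚ × List ℕ)) w →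
                      coeff (concatMap (λ { (c , A) → scale c (g A) }) L) w ≡ ∑ (λ { (c , A) → c * coeff (g A) w }) L
  coeff-combination g L w =
    trans (coeff-concatMap (λ { (c , A) → scale c (g A) }) L w) (∑-cong L (λ { (c , A) _ → coeff-scale c (g A) w }))

  InSpan-NCSym⁺ : ∀ f → InNCSym⁺ n f → InSpan n f
  InSpan-NCSym⁺ f ((L , rgfs , f≈) , f[]≡0) =
    InSpan-≈ {p = f} f≈⁺
      (InSpan-concatMap _ L (λ { (c , A) cA∈ → InSpan-scale c (InSpan-mA⁺ A (All.lookup rgfs cA∈)) }))
    where
    open ≡-Reasoning
    f≈⁺ : f ≈ concatMap (λ { (c , A) → scale c (mA⁺ A) }) L
    f≈⁺ [] = begin
      coeff f []                                    ≡⟨ f[]≡0 ⟩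
      0ℚ                                            ≡⟨ sym (∑-zero L (λ { (c , A) cA∈ → c*0 c A (All.lookup rgfs cA∈) })) ⟩
      ∑ (λ { (c , A) → c * coeff (mA⁺ A) [] }) L    ≡⟨ sym (coeff-combination mA⁺ L []) ⟩
      coeff (concatMap (λ { (c , A) → scale c (mA⁺ A) }) L) []  ∎
      where
      c*0 : ∀ c A → IsSetPartition A → c * coeff (mA⁺ A) [] ≡ 0ℚ
      c*0 c [] _ = ℚ.*-zeroʳ c
      c*0 c A@(_ ∷ _) rgf = trans (cong (c *_) (coeff-mA-[] A rgf (λ ()))) (ℚ.*-zeroʳ c)
    f≈⁺ (x ∷ w) = begin
      coeff f (x ∷ w)                                              ≡⟨ f≈ (x ∷ w) ⟩
      coeff (concatMap (λ { (c , A) → scale c (mA n A) }) L) (x ∷ w) ≡⟨ coeff-combination (mA n) L (x ∷ w) ⟩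
      ∑ (λ { (c , A) → c * coeff (mA n A) (x ∷ w) }) L             ≡⟨ ∑-cong L (λ { (c , A) _ → cong (c *_) (same A) }) ⟩
      ∑ (λ { (c , A) → c * coeff (mA⁺ A) (x ∷ w) }) L              ≡⟨ sym (coeff-combination mA⁺ L (x ∷ w)) ⟩
      coeff (concatMap (λ { (c , A) → scale c (mA⁺ A) }) L) (x ∷ w) ∎
      where
      same : ∀ A → coeff (mA n A) (x ∷ w) ≡ coeff (mA⁺ A) (x ∷ w)
      same [] = refl
      same (_ ∷ _) = refl

  InSpan-ideal : ∀ p → InIdeal n p → InSpan n p
  InSpan-ideal p (L , inNCSym⁺ , p≈) =
    InSpan-≈ {p = p} p≈
      (InSpan-concatMap _ L (λ { (q , f) qf∈ → InSpan-*ₚ q (InSpan-NCSym⁺ f (All.lookup inNCSym⁺ qf∈)) }))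

  basisElt-InIdeal : ∀ i → IsBasisIndex n i → InIdeal n (basisElt n i)
  basisElt-InIdeal (u , A) (rgf , (A≢[] , _) , _) =
    [ ([ (1ℚ , u) ] , mA n A) ] , (mA∈NCSym , coeff-mA-[] A rgf A≢[]) ∷ [] , ≈-reflexive (sym product≡)
    where
    mA∈NCSym : InNCSym n (mA n A)
    mA∈NCSym = [ (1ℚ , A) ] , rgf ∷ [] , ≈-reflexive (sym (trans (List.++-identityʳ _) (scale-1 (mA n A))))
    product≡ : ([ (1ℚ , u) ] *ₚ mA n A) ++ [] ≡ wordMul u (mA n A)
    product≡ = begin
      ([ (1ℚ , u) ] *ₚ mA n A) ++ []             ≡⟨ List.++-identityʳ _ ⟩
      [ (1ℚ , u) ] *ₚ mA n A                     ≡⟨ *ₚ-∷ 1ℚ u [] (mA n A) ⟩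
      scale 1ℚ (wordMul u (mA n A)) ++ []        ≡⟨ List.++-identityʳ _ ⟩
      scale 1ℚ (wordMul u (mA n A))              ≡⟨ scale-1 _ ⟩
      wordMul u (mA n A)                         ∎
      where open ≡-Reasoning

-- Linear independence

module _ {n : ℕ} where

  weighted : List (ℚ × Idx n) → (Idx n → ℚ) → ℚ
  weighted L g = ∑ (λ { (c , k) → c * g k }) L

  coeff-comb : ∀ L w → coeff (comb n L) w ≡ weighted L (λ k → coeff (basisElt n k) w)
  coeff-comb L w = trans (coeff-concatMap term L w) (∑-cong L (λ { (c , k) _ → coeff-scale c (basisElt n k) w }))

  idxCoeff-here : ∀ c k (L : List (ℚ × Idx n)) → idxCoeff ((c , k) ∷ L) k ≡ c + idxCoeff L k
  idxCoeff-here c (u , A) L with u ≟W u | A ≟L A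
  ... | yes refl | yes refl = refl
  ... | no u≢u   | _        = ⊥-elim (u≢u refl)
  ... | yes _    | no A≢A   = ⊥-elim (A≢A refl)

  idxCoeff-there : ∀ c k j (L : List (ℚ × Idx n)) → k ≢ j → idxCoeff ((c , k) ∷ L) j ≡ idxCoeff L j
  idxCoeff-there c (u , A) (v , B) L k≢j with u ≟W v | A ≟L B
  ... | yes refl | yes refl = ⊥-elim (k≢j refl)
  ... | no _     | _        = refl
  ... | yes refl | no _     = refl

  without : Idx n → List (ℚ × Idx n) → List (ℚ × Idx n)
  without j = filter (λ ci → ¬? (decIdx (proj₂ ci) j))

  without-here : ∀ c j L → without j ((c , j) ∷ L) ≡ without j L
  without-here c j L = List.filter-reject (λ ci → ¬? (decIdx (proj₂ ci) j)) (λ j≢j → j≢j refl)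

  without-there : ∀ c k j L → k ≢ j → without j ((c , k) ∷ L) ≡ (c , k) ∷ without j L
  without-there c k j L = List.filter-accept (λ ci → ¬? (decIdx (proj₂ ci) j))

  weighted-without : ∀ L g j → weighted L g ≡ idxCoeff L j * g j + weighted (without j L) g
  weighted-without [] g j = sym (trans (cong (_+ 0ℚ) (ℚ.*-zeroˡ (g j))) (ℚ.+-identityʳ 0ℚ))
  weighted-without ((c , k) ∷ L) g j = split (decIdx k j)
    where
    open ≡-Reasoning
    split : Dec (k ≡ j) → weighted ((c , k) ∷ L) g ≡ idxCoeff ((c , k) ∷ L) j * g j + weighted (without j ((c , k) ∷ L)) g
    split (yes refl) = begin
      c * g k + weighted L g
        ≡⟨ cong (c * g k +_) (weighted-without L g k) ⟩
      c * g k + (idxCoeff L k * g k + weighted (without k L) g)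
        ≡⟨ solve 4 (λ c x a s → c :* x :+ (a :* x :+ s) := (c :+ a) :* x :+ s) refl c (g k) (idxCoeff L k) _ ⟩
      (c + idxCoeff L k) * g k + weighted (without k L) g
        ≡⟨ sym (cong₂ (λ a M → a * g k + weighted M g) (idxCoeff-here c k L) (without-here c k L)) ⟩
      idxCoeff ((c , k) ∷ L) k * g k + weighted (without k ((c , k) ∷ L)) g
        ∎
    split (no k≢j) = begin
      c * g k + weighted L g
        ≡⟨ cong (c * g k +_) (weighted-without L g j) ⟩
      c * g k + (idxCoeff L j * g j + weighted (without j L) g)
        ≡⟨ solve 3 (λ a b s → a :+ (b :+ s) := b :+ (a :+ s)) refl (c * g k) (idxCoeff L j * g j) _ ⟩
      idxCoeff L j * g j + weighted ((c , k) ∷ without j L) g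
        ≡⟨ sym (cong₂ (λ a M → a * g j + weighted M g) (idxCoeff-there c k j L k≢j) (without-there c k j L k≢j)) ⟩
      idxCoeff ((c , k) ∷ L) j * g j + weighted (without j ((c , k) ∷ L)) g
        ∎

  idxCoeff-without-self : ∀ L j → idxCoeff (without j L) j ≡ 0ℚ
  idxCoeff-without-self [] j = refl
  idxCoeff-without-self ((c , k) ∷ L) j = split (decIdx k j)
    where
    split : Dec (k ≡ j) → idxCoeff (without j ((c , k) ∷ L)) j ≡ 0ℚ
    split (yes refl) = trans (cong (λ M → idxCoeff M k) (without-here c k L)) (idxCoeff-without-self L k)
    split (no k≢j)   = trans (cong (λ M → idxCoeff M j) (without-there c k j L k≢j))
                         (trans (idxCoeff-there c k j (without j L) k≢j) (idxCoeff-without-self L j))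

  idxCoeff-without-other : ∀ L j k → k ≢ j → idxCoeff (without j L) k ≡ idxCoeff L k
  idxCoeff-without-other [] j k _ = refl
  idxCoeff-without-other ((c , k′) ∷ L) j k k≢j = split (decIdx k′ j) (decIdx k′ k)
    where
    open ≡-Reasoning
    split : Dec (k′ ≡ j) → Dec (k′ ≡ k) → idxCoeff (without j ((c , k′) ∷ L)) k ≡ idxCoeff ((c , k′) ∷ L) k
    split (yes refl) (yes refl) = ⊥-elim (k≢j refl)
    split (yes refl) (no k′≢k)  = begin
      idxCoeff (without k′ ((c , k′) ∷ L)) k   ≡⟨ cong (λ M → idxCoeff M k) (without-here c k′ L) ⟩
      idxCoeff (without k′ L) k                ≡⟨ idxCoeff-without-other L k′ k k≢j ⟩
      idxCoeff L k                             ≡⟨ sym (idxCoeff-there c k′ k L k′≢k) ⟩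
      idxCoeff ((c , k′) ∷ L) k                ∎
    split (no k′≢j) (yes refl)  = begin
      idxCoeff (without j ((c , k′) ∷ L)) k′   ≡⟨ cong (λ M → idxCoeff M k′) (without-there c k′ j L k′≢j) ⟩
      idxCoeff ((c , k′) ∷ without j L) k′     ≡⟨ idxCoeff-here c k′ (without j L) ⟩
      c + idxCoeff (without j L) k′            ≡⟨ cong (c +_) (idxCoeff-without-other L j k′ k≢j) ⟩
      c + idxCoeff L k′                        ≡⟨ sym (idxCoeff-here c k′ L) ⟩
      idxCoeff ((c , k′) ∷ L) k′               ∎
    split (no k′≢j) (no k′≢k)   = begin
      idxCoeff (without j ((c , k′) ∷ L)) k    ≡⟨ cong (λ M → idxCoeff M k) (without-there c k′ j L k′≢j) ⟩
      idxCoeff ((c , k′) ∷ without j L) k      ≡⟨ idxCoeff-there c k′ k (without j L) k′≢k ⟩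
      idxCoeff (without j L) k                 ≡⟨ idxCoeff-without-other L j k k≢j ⟩
      idxCoeff L k                             ≡⟨ sym (idxCoeff-there c k′ k L k′≢k) ⟩
      idxCoeff ((c , k′) ∷ L) k                ∎

  length-without-∷ : ∀ c j L → length (without j ((c , j) ∷ L)) < suc (length L)
  length-without-∷ c j L rewrite without-here c j L = s≤s (List.length-filter _ L)

  weighted-collect : ∀ L g i → (∀ {c k} → (c , k) ∈ L → k ≢ i → g k ≡ 0ℚ ⊎ idxCoeff L k ≡ 0ℚ) →
                     weighted L g ≡ idxCoeff L i * g i
  weighted-collect L g i = go L (<-wellFounded (length L))
    where
    go : ∀ L → Acc _<_ (length L) → (∀ {c k} → (c , k) ∈ L → k ≢ i → g k ≡ 0ℚ ⊎ idxCoeff L k ≡ 0ℚ) →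
         weighted L g ≡ idxCoeff L i * g i
    go [] _ _ = sym (ℚ.*-zeroˡ (g i))
    go L@((c , j) ∷ L′) (acc smaller) negligible =
      trans (weighted-without L g j) (collect (decIdx j i))
      where
      negligible′ : ∀ {c′ k} → (c′ , k) ∈ without j L → k ≢ i → g k ≡ 0ℚ ⊎ idxCoeff (without j L) k ≡ 0ℚ
      negligible′ {k = k} k∈ k≢i with ∈.∈-filter⁻ (λ ci → ¬? (decIdx (proj₂ ci) j)) {xs = L} k∈
      ... | k∈L , k≢j with negligible k∈L k≢i
      ...   | inj₁ gk≡0  = inj₁ gk≡0
      ...   | inj₂ idx≡0 = inj₂ (trans (idxCoeff-without-other L j k k≢j) idx≡0)
      rest : weighted (without j L) g ≡ idxCoeff (without j L) i * g i
      rest = go (without j L) (smaller (length-without-∷ c j L′)) negligible′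
      collect : Dec (j ≡ i) → idxCoeff L j * g j + weighted (without j L) g ≡ idxCoeff L i * g i
      collect (yes refl) = begin
        idxCoeff L j * g j + weighted (without j L) g              ≡⟨ cong (idxCoeff L j * g j +_) rest ⟩
        idxCoeff L j * g j + idxCoeff (without j L) j * g j        ≡⟨ cong (λ z → idxCoeff L j * g j + z * g j) (idxCoeff-without-self L j) ⟩
        idxCoeff L j * g j + 0ℚ * g j                              ≡⟨ cong (idxCoeff L j * g j +_) (ℚ.*-zeroˡ (g j)) ⟩
        idxCoeff L j * g j + 0ℚ                                    ≡⟨ ℚ.+-identityʳ _ ⟩
        idxCoeff L j * g j                                         ∎
        where open ≡-Reasoning
      collect (no j≢i) = begin
        idxCoeff L j * g j + weighted (without j L) g              ≡⟨ cong₂ _+_ head≡0 rest ⟩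
        0ℚ + idxCoeff (without j L) i * g i                        ≡⟨ ℚ.+-identityˡ _ ⟩
        idxCoeff (without j L) i * g i                             ≡⟨ cong (_* g i) (idxCoeff-without-other L j i (j≢i ∘ sym)) ⟩
        idxCoeff L i * g i                                         ∎
        where
        open ≡-Reasoning
        head≡0 : idxCoeff L j * g j ≡ 0ℚ
        head≡0 with negligible (here refl) j≢i
        ... | inj₁ gj≡0   = trans (cong (idxCoeff L j *_) gj≡0) (ℚ.*-zeroʳ (idxCoeff L j))
        ... | inj₂ idx≡0 = trans (cong (_* g j) idx≡0) (ℚ.*-zeroˡ (g j))

  leading : Idx n → List ℕ
  leading (u , A) = map toℕ u ++ A

  leadingWord : ∀ i → IsBasisIndex n i → Word n
  leadingWord (u , A) (_ , _ , ℓ≤n) = u ++ LT-mA A (ℓ≤⇒All< A ℓ≤n)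

  leading-bound : ∀ i → IsBasisIndex n i → All (_< n) (leading i)
  leading-bound (u , A) (_ , _ , ℓ≤n) = All.++⁺ (All.map⁺ (All.universal Fin.toℕ<n u)) (ℓ≤⇒All< A ℓ≤n)

  toℕ-leadingWord : ∀ i (b : IsBasisIndex n i) → map toℕ (leadingWord i b) ≡ leading i
  toℕ-leadingWord (u , A) (_ , _ , ℓ≤n) =
    trans (List.map-++ toℕ u _) (cong (map toℕ u ++_) (toℕ-LT-mA A (ℓ≤⇒All< A ℓ≤n)))

  leadingWord-InC : ∀ A (b : IsBasisIndex n ([] , A)) → InC n (leadingWord ([] , A) b)
  leadingWord-InC A (rgf , nonsplit , ℓ≤n) = A , rgf , nonsplit , ℓ≤⇒All< A ℓ≤n , refl

  std-LT-mA : ∀ A → IsSetPartition A → (A<n : All (_< n) A) → W.std (LT-mA A A<n) ≡ A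
  std-LT-mA A rgf A<n = begin
    W.std (LT-mA A A<n)             ≡⟨ sym (std-toℕ (LT-mA A A<n)) ⟩
    N.std (map toℕ (LT-mA A A<n))   ≡⟨ cong N.std (toℕ-LT-mA A A<n) ⟩
    N.std A                         ≡⟨ std-setPartition A rgf ⟩
    A                               ∎
    where open ≡-Reasoning

  coeff-leadingWord : ∀ i (b : IsBasisIndex n i) → coeff (basisElt n i) (leadingWord i b) ≡ 1ℚ
  coeff-leadingWord (u , A) (rgf , _ , ℓ≤n) = begin
    coeff (wordMul u (mA n A)) (u ++ LT-mA A A<n)   ≡⟨ coeff-wordMul-++ u (mA n A) (LT-mA A A<n) ⟩
    coeff (mA n A) (LT-mA A A<n)                    ≡⟨ coeff-mA A (LT-mA A A<n) rgf ⟩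
    𝟙 (W.std (LT-mA A A<n) ≟L A)                    ≡⟨ 𝟙-yes (W.std (LT-mA A A<n) ≟L A) (std-LT-mA A rgf A<n) ⟩
    1ℚ                                              ∎
    where
    open ≡-Reasoning
    A<n = ℓ≤⇒All< A ℓ≤n

  basisElt-support : ∀ u A w → IsSetPartition A → coeff (basisElt n (u , A)) w ≢ 0ℚ → ∃ λ v → w ≡ u ++ v × W.std v ≡ A
  basisElt-support u A w rgf ≢0 with 𝟙*≢0 (u ≟W take (length u) w) _ (≢0 ∘ trans (coeff-wordMul u (mA n A) w))
  ... | u≡take , mA≢0 =
    v , trans (sym (List.take++drop≡id (length u) w)) (cong (_++ v) (sym u≡take)) ,
    𝟙≢0 (W.std v ≟L A) (mA≢0 ∘ trans (coeff-mA A v rgf))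
    where v = drop (length u) w

  -- Equal leading words force j ≡ i, by unique factorisation.
  triangular : ∀ j i (bj : IsBasisIndex n j) (bi : IsBasisIndex n i) →
               coeff (basisElt n j) (leadingWord i bi) ≢ 0ℚ → j ≡ i ⊎ leading j <lex leading i
  triangular (u′ , A′) (u , A) (rgf′ , nonsplit′ , ℓ′≤n) bi@(rgf , nonsplit , ℓ≤n) ≢0
    with basisElt-support u′ A′ (leadingWord (u , A) bi) rgf′ ≢0
  ... | v , lw≡ , std≡A′ = compare (std-≤lex (map toℕ v))
    where
    A′≡ : A′ ≡ N.std (map toℕ v)
    A′≡ = trans (sym std≡A′) (sym (std-toℕ v))
    leading-i≡ : leading (u , A) ≡ map toℕ u′ ++ map toℕ v
    leading-i≡ = trans (sym (toℕ-leadingWord (u , A) bi)) (trans (cong (map toℕ) lw≡) (List.map-++ toℕ u′ v))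
    compare : N.std (map toℕ v) ≤lex map toℕ v → (u′ , A′) ≡ (u , A) ⊎ leading (u′ , A′) <lex leading (u , A)
    compare (inj₁ lt) = inj₂ (subst₂ (λ B E → map toℕ u′ ++ B <lex E) (sym A′≡) (sym leading-i≡) (<lex-++ (map toℕ u′) lt))
    compare (inj₂ eq) = inj₁ (cong₂ _,_ (sym (proj₁ same)) A′≡A)
      where
      A′<n = ℓ≤⇒All< A′ ℓ′≤n
      v≡LT : v ≡ LT-mA A′ A′<n
      v≡LT = List.map-injective Fin.toℕ-injective (trans (sym eq) (trans (sym A′≡) (sym (toℕ-LT-mA A′ A′<n))))
      same = factorisation-unique u _ u′ (LT-mA A′ A′<n) (leadingWord-InC A ( rgf , nonsplit , ℓ≤n))
                                  (leadingWord-InC A′ (rgf′ , nonsplit′ , ℓ′≤n)) (trans lw≡ (cong (u′ ++_) v≡LT))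
      A′≡A : A′ ≡ A
      A′≡A = trans (sym (toℕ-LT-mA A′ A′<n)) (trans (cong (map toℕ) (sym (proj₂ same))) (toℕ-LT-mA A (ℓ≤⇒All< A ℓ≤n)))

  idxCoeff-absent : ∀ L i → ¬ Any (λ ci → proj₂ ci ≡ i) L → idxCoeff L i ≡ 0ℚ
  idxCoeff-absent [] i _ = refl
  idxCoeff-absent ((c , k) ∷ L) i absent =
    trans (idxCoeff-there c k i L (absent ∘ here)) (idxCoeff-absent L i (absent ∘ there))

  independent : ∀ L → AllBasis n L → comb n L ≈ [] → ∀ i → idxCoeff L i ≡ 0ℚ
  independent L basis L≈0 i = go i (<-wellFounded (horner n (leading i)))
    where
    go : ∀ i → Acc _<_ (horner n (leading i)) → idxCoeff L i ≡ 0ℚ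
    go i (acc smaller) with any? (λ ci → decIdx (proj₂ ci) i) L
    ... | no absent = idxCoeff-absent L i absent
    ... | yes present with find present
    ...   | _ , ci∈ , refl = begin
      idxCoeff L i                         ≡⟨ sym (ℚ.*-identityʳ _) ⟩
      idxCoeff L i * 1ℚ                    ≡⟨ cong (idxCoeff L i *_) (sym (coeff-leadingWord i bi)) ⟩
      idxCoeff L i * g i                   ≡⟨ sym (weighted-collect L g i negligible) ⟩
      weighted L g                         ≡⟨ sym (coeff-comb L (leadingWord i bi)) ⟩
      coeff (comb n L) (leadingWord i bi)  ≡⟨ L≈0 (leadingWord i bi) ⟩
      0ℚ                                   ∎
      where
      open ≡-Reasoning
      bi = All.lookup basis ci∈
      g : Idx n → ℚ
      g k = coeff (basisElt n k) (leadingWord i bi)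
      negligible : ∀ {c k} → (c , k) ∈ L → k ≢ i → g k ≡ 0ℚ ⊎ idxCoeff L k ≡ 0ℚ
      negligible {k = k} k∈ k≢i with g k ℚ.≟ 0ℚ
      ... | yes gk≡0 = inj₁ gk≡0
      ... | no gk≢0 with triangular k i (All.lookup basis k∈) bi gk≢0
      ...   | inj₁ k≡i = ⊥-elim (k≢i k≡i)
      ...   | inj₂ k<i =
        inj₂ (go k (smaller (horner-<lex n (leading-bound k (All.lookup basis k∈)) (leading-bound i bi) k<i)))

mainTheorem19 : (n : ℕ) → 1 ≤ n → IsLinearBasisOfIdeal n × UniqueFactorisation n
mainTheorem19 n _ = (basisElt-InIdeal , spanning , independent) , uniqueFactorisation n
  where
  spanning : ∀ p → InIdeal n p → Σ (List (ℚ × Idx n)) λ L → AllBasis n L × p ≈ comb n L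
  spanning p p∈I = let spanned L basis p≈L = InSpan-ideal p p∈I in L , basis , p≈L
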